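{- Let $\mathcal{F}\subseteq\mathcal{B}^{<\omega}(\mathbb{N})$, let $1\le\xi<\omega_1$ and let $\mathcal{D}$ be an infinite disjoint collection. The following are equivalent: (i) $\mathcal{B}^\xi\cap\mathcal{B}^{<\omega}(\mathcal{D})\subseteq\mathcal{F}$; (ii) for every infinite disjoint collection $\mathcal{D}_1<\mathcal{D}$, the unique initial segment of $\mathcal{D}_1$ which is an element of $\mathcal{B}^\xi$ belongs to $\mathcal{F}$; (iii) for every sequence $(\mathcal{D}_n)_{n\in\mathbb{N}}$ of infinite disjoint collections with $\mathcal{D}_n<\mathcal{D}$ for all $n$, and every choice of $s_n\in FU(\mathcal{D}_n)$ ($n\in\mathbb{N}$) with $s_1<s_2<\cdots$, there exists $n_0\in\mathbb{N}$ with $(s_1,\dots,s_{n_0})\in\mathcal{B}^\xi\cap\mathcal{F}$.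
   Context: $\mathbb{N}=\{1,2,\dots\}$. For nonempty $s,t\subseteq\mathbb{N}$ with $s$ finite, $s<t$ means $\max s<\min t$. A finite disjoint collection is a tuple $(s_1,\dots,s_k)$, $k\ge0$ ($\emptyset$ for $k=0$), of nonempty finite subsets with $s_1<\dots<s_k$; $\mathcal{B}^{<\omega}(\mathbb{N})$ is their set; an infinite disjoint collection is a sequence $(s_n)$ of nonempty finite subsets with $s_n<s_{n+1}$; collections are identified with the set of their members. $FU(\mathcal{D})$: unions of finitely many (at least one) members of $\mathcal{D}$; $\mathcal{D}_1<\mathcal{D}$ means $\mathcal{D}_1\subseteq FU(\mathcal{D})$; $\mathcal{B}^{<\omega}(\mathcal{D})$: finite disjoint collections with all members in $FU(\mathcal{D})$. (Every infinite disjoint collection has exactly one initial segment in $\mathcal{B}^\xi$ for $\xi\ge1$.) Schreier families: fix for each countable limit $\lambda>0$ a strictly increasing sequence $(\lambda_n)$ of successor ordinals $<\lambda$ with supremum $\lambda$. $\mathcal{A}_0=\{\emptyset\}$; $\mathcal{A}_{\zeta+1}=\{\{n\}\cup s_1:s_1\in\mathcal{A}_\zeta,\{n\}<s_1\}$ ($\{n\}<\emptyset$ vacuous); $\mathcal{A}_{\omega^{\beta+1}}=\{s_1\cup\dots\cup s_n:s_1<\dots<s_n\in\mathcal{A}_{\omega^\beta},n=\min s_1\}$; for limit $\lambda>0$, $\mathcal{A}_{\omega^\lambda}=\{s:s\in\mathcal{A}_{\omega^{\lambda_n}},n=\min s\}$; for limit $\xi$ with $\omega^a<\xi<\omega^{a+1}$,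 $\xi=p\omega^a+\sum_{i=1}^m p_i\omega^{a_i}$ ($m\ge0$, $p,p_i\ge1$, $a>a_1>\dots>a_m>0$, $p>1$ or $m\ge1$): $\mathcal{A}_\xi=\{s_0\cup\dots\cup s_m:s_m<\dots<s_0,\ s_0=s^0_1\cup\dots\cup s^0_p$ with $s^0_1<\dots<s^0_p\in\mathcal{A}_{\omega^a}$, $s_i=s^i_1\cup\dots\cup s^i_{p_i}$ with $s^i_1<\dots<s^i_{p_i}\in\mathcal{A}_{\omega^{a_i}}\}$. For $\xi\ge1$, $\mathcal{B}^\xi=\{(s_1,\dots,s_k):k\ge1,\ s_1<\dots<s_k,\ \{\min s_1,\dots,\min s_k\}\in\mathcal{A}_\xi\}$. -}

module Defs where

open import Data.Nat using (ℕ; zero; suc; _<_; _≤_)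
open import Data.List using (List; []; _∷_; concat; concatMap; map; length; reverse; replicate; applyUpTo)
open import Data.List.Relation.Unary.All using (All)
open import Data.List.Relation.Unary.Linked using (Linked)
open import Data.List.Relation.Binary.Pointwise using (Pointwise)
open import Data.Product using (Σ; _×_; _,_; proj₁; proj₂)
open import Data.Sum using (_⊎_)
open import Data.Unit using (⊤)
open import Data.Empty using (⊥)
open import Relation.Nullary using (¬_)
open import Relation.Binary.PropositionalEquality using (_≡_)

-- Countable ordinals as Brouwer trees.  'olim f' denotes the supremum
-- of the ordinals denoted by 'f 0, f 1, ...'.  Every countable ordinal
-- (i.e. every ordinal < ω₁) is denoted by some tree and vice versa.

data Ord : Set where
  ozero : Ord
  osuc  : Ord → Ord
  olim  : (ℕ → Ord) → Ord

mutual
  _≤ₒ_ : Ord → Ord → Set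
  ozero  ≤ₒ y = ⊤
  osuc x ≤ₒ y = x <ₒ y
  olim f ≤ₒ y = ∀ n → f n ≤ₒ y

  _<ₒ_ : Ord → Ord → Set
  x <ₒ ozero  = ⊥
  x <ₒ osuc y = x ≤ₒ y
  x <ₒ olim f = Σ ℕ (λ n → x <ₒ f n)

infix 4 _≤ₒ_ _<ₒ_ _≈ₒ_

_≈ₒ_ : Ord → Ord → Set
x ≈ₒ y = (x ≤ₒ y) × (y ≤ₒ x)

_+ₒ_ : Ord → Ord → Ord
x +ₒ ozero  = x
x +ₒ osuc y = osuc (x +ₒ y)
x +ₒ olim f = olim (λ n → x +ₒ f n)

_·ₒ_ : Ord → Ord → Ord
x ·ₒ ozero  = ozero
x ·ₒ osuc y = (x ·ₒ y) +ₒ x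
x ·ₒ olim f = olim (λ n → x ·ₒ f n)

fromℕₒ : ℕ → Ord
fromℕₒ zero    = ozero
fromℕₒ (suc n) = osuc (fromℕₒ n)

ω^_ : Ord → Ord
ω^ ozero  = osuc ozero
ω^ osuc x = olim (λ n → (ω^ x) ·ₒ fromℕₒ n)
ω^ olim f = olim (λ n → ω^ f n)

IsLimit : Ord → Set
IsLimit γ = (ozero <ₒ γ) × (∀ β → β <ₒ γ → osuc β <ₒ γ)

IsSucc : Ord → Set
IsSucc x = Σ Ord (λ β → x ≈ₒ osuc β)

-- The fixed choice, for each countable limit ordinal γ > 0, of a strictly
-- increasing sequence (γ_n)_{n ≥ 1} of successor ordinals < γ with
-- supremum γ.  The choice depends only on the ordinal γ (fs-ext).
-- Entries at index 0 are irrelevant (ℕ = {1,2,...} in the paper).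
record FundSeq : Set where
  field
    fs         : (γ : Ord) → IsLimit γ → ℕ → Ord
    fs-succ    : ∀ γ l n → 1 ≤ n → IsSucc (fs γ l n)
    fs-mono    : ∀ γ l n → 1 ≤ n → fs γ l n <ₒ fs γ l (suc n)
    fs-below   : ∀ γ l n → 1 ≤ n → fs γ l n <ₒ γ
    fs-cofinal : ∀ γ l β → β <ₒ γ → Σ ℕ (λ n → (1 ≤ n) × (β <ₒ fs γ l n))
    fs-ext     : ∀ γ γ′ l l′ n → γ ≈ₒ γ′ → fs γ l n ≈ₒ fs γ′ l′ n

-- Finite subsets of ℕ are represented by strictly increasing lists.

NE : {A : Set} → List A → Set
NE xs = ¬ (xs ≡ [])

minL : List ℕ → ℕ
minL []      = 0
minL (x ∷ _) = x

_≺_ : List ℕ → List ℕ → Set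
s ≺ t = NE s × NE t × All (λ x → All (λ y → x < y) t) s

NEFinSet : List ℕ → Set
NEFinSet s = NE s × Linked _<_ s × All (λ x → 1 ≤ x) s

cnfVal : List (Ord × ℕ) → Ord
cnfVal []             = ozero
cnfVal ((e , c) ∷ ts) = ((ω^ e) ·ₒ fromℕₒ c) +ₒ cnfVal ts

expand : List (Ord × ℕ) → List Ord
expand ts = reverse (concatMap (λ t → replicate (proj₂ t) (proj₁ t)) ts)

data 𝒜 (F : FundSeq) : Ord → List ℕ → Set where
  a-zero : ∀ {ξ} → ξ ≈ₒ ozero → 𝒜 F ξ []
  a-suc  : ∀ {ξ ζ n s} → ξ ≈ₒ osuc ζ → 𝒜 F ζ s → All (λ m → n < m) s →
           𝒜 F ξ (n ∷ s)
  a-pow-suc : ∀ {ξ β} (ss : List (List ℕ)) → ξ ≈ₒ ω^ (osuc β) →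
           NE ss → All (𝒜 F (ω^ β)) ss → All NE ss → Linked _≺_ ss →
           length ss ≡ minL (concat ss) → 𝒜 F ξ (concat ss)
  a-pow-lim : ∀ {ξ γ s} (l : IsLimit γ) → ξ ≈ₒ ω^ γ → NE s →
           𝒜 F (ω^ (FundSeq.fs F γ l (minL s))) s → 𝒜 F ξ s
  a-cnf : ∀ {ξ} (a : Ord) (p : ℕ) (ts : List (Ord × ℕ)) (ps : List (List ℕ)) →
           ξ ≈ₒ cnfVal ((a , p) ∷ ts) →
           1 ≤ p → All (λ t → 1 ≤ proj₂ t) ts →
           Linked (λ t u → proj₁ u <ₒ proj₁ t) ((a , p) ∷ ts) →
           All (λ t → ozero <ₒ proj₁ t) ((a , p) ∷ ts) →
           (1 < p ⊎ NE ts) →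
           Pointwise (λ e s → 𝒜 F (ω^ e) s) (expand ((a , p) ∷ ts)) ps →
           All NE ps → Linked _≺_ ps →
           𝒜 F ξ (concat ps)

FinColl : List (List ℕ) → Set
FinColl c = All NEFinSet c × Linked _≺_ c

InfColl : (ℕ → List ℕ) → Set
InfColl D = (∀ n → NEFinSet (D n)) × (∀ n → D n ≺ D (suc n))

FU : (ℕ → List ℕ) → List ℕ → Set
FU D t = Σ (List ℕ) (λ I → NE I × Linked _<_ I × t ≡ concatMap D I)

_<ᶜ_ : (ℕ → List ℕ) → (ℕ → List ℕ) → Set
D₁ <ᶜ D = ∀ n → FU D (D₁ n)

BfinOf : (ℕ → List ℕ) → List (List ℕ) → Set
BfinOf D c = FinColl c × All (FU D) c

𝓑 : FundSeq → Ord → List (List ℕ) → Set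
𝓑 F ξ c = NE c × FinColl c × 𝒜 F ξ (map minL c)

initSeg : (ℕ → List ℕ) → ℕ → List (List ℕ)
initSeg D k = applyUpTo D k

CondI : FundSeq → (List (List ℕ) → Set) → Ord → (ℕ → List ℕ) → Set
CondI F 𝓕 ξ D = ∀ c → 𝓑 F ξ c → BfinOf D c → 𝓕 c

CondII : FundSeq → (List (List ℕ) → Set) → Ord → (ℕ → List ℕ) → Set
CondII F 𝓕 ξ D = ∀ D₁ → InfColl D₁ → D₁ <ᶜ D →
  ∀ k → 𝓑 F ξ (initSeg D₁ k) → 𝓕 (initSeg D₁ k)

CondIII : FundSeq → (List (List ℕ) → Set) → Ord → (ℕ → List ℕ) → Set
CondIII F 𝓕 ξ D = ∀ (Ds : ℕ → ℕ → List ℕ) → (∀ n → InfColl (Ds n)) →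
  (∀ n → Ds n <ᶜ D) →
  ∀ (s : ℕ → List ℕ) → (∀ n → FU (Ds n) (s n)) → (∀ n → s n ≺ s (suc n)) →
  Σ ℕ (λ n₀ → (1 ≤ n₀) × 𝓑 F ξ (initSeg s n₀) × 𝓕 (initSeg s n₀))

{-# OPTIONS --safe #-}
-- Two facts about the Schreier families carry the proof.  Every strictly
-- increasing sequence of positive integers has an initial segment in 𝒜_ξ;
-- this gives (ii) ⇒ (iii), because the minima of s₁ < s₂ < ⋯ form such a
-- sequence and (sₙ) is itself an infinite disjoint collection below 𝒟.  And
-- 𝒜_ξ is thin: two members one of which is an initial segment of the other
-- are equal; this gives (iii) ⇒ (i), because a given c ∈ 𝓑^ξ ∩ 𝓑^{<ω}(𝒟),
-- extended by a tail of 𝒟, is then the only initial segment of the extension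
-- lying in 𝓑^ξ.  Both facts are proved by induction on ξ along the clauses
-- defining 𝒜, which requires every countable ordinal to be zero, a successor,
-- ω^(β+1), ω^γ with γ a limit, or a longer Cantor normal form, in exactly one
-- way; this is where excluded middle is used.
module Submission where

open import Defs
open import Level using (0ℓ)
open import Axiom.ExcludedMiddle using (ExcludedMiddle)
open import Axiom.DoubleNegationElimination using (em⇒dne)
open import Data.Empty using (⊥-elim)
open import Data.Unit using (tt)
open import Data.Product using (Σ; _×_; _,_; proj₁; proj₂; swap)
open import Data.Sum using (_⊎_; inj₁; inj₂)
open import Data.Maybe using (just)
open import Data.Maybe.Relation.Binary.Connected using (Connected; just; just-nothing)
open import Data.Nat as ℕ using (ℕ; zero; suc; z≤n; s≤s; _+_)
import Data.Nat.Properties as ℕₚ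
open import Data.List using (List; []; _∷_; _++_; concat; concatMap; map; head; length; replicate; applyUpTo)
import Data.List.Properties as Listₚ
open import Data.List.Extrema ℕₚ.≤-totalOrder using (max; xs≤max)
open import Data.List.Relation.Unary.All as All using (All; []; _∷_)
import Data.List.Relation.Unary.All.Properties as Allₚ
import Data.List.Relation.Unary.AllPairs as AllPairs
import Data.List.Relation.Unary.AllPairs.Properties as AllPairsₚ
open import Data.List.Relation.Unary.Linked as Linked using (Linked; []; [-]; _∷_; _∷′_)
import Data.List.Relation.Unary.Linked.Properties as Linkedₚ
open import Data.List.Relation.Binary.Pointwise as Pointwise using (Pointwise; []; _∷_)
open import Data.List.Relation.Binary.Permutation.Propositional using (↭-sym)
open import Data.List.Relation.Binary.Permutation.Propositional.Properties using (All-resp-↭; ↭-reverse)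
open import Function using (_∘_)
open import Induction.WellFounded using (Acc; acc; WellFounded)
open import Relation.Nullary using (¬_; yes; no)
open import Relation.Binary using (tri<; tri≈; tri>)
open import Relation.Binary.Definitions using (Transitive)
open import Relation.Binary.Structures using (IsPreorder)
open import Relation.Binary.PropositionalEquality using (_≡_; refl; sym; trans; cong; cong₂; subst; subst₂)

-- Order on Brouwer trees

-- _≤ₒ_ and _<ₒ_ compute by recursion, so Agda cannot infer ordinals from
-- them; ordinal arguments of lemmas about them are therefore explicit.
≤ₒ-olim : ∀ x f n → x ≤ₒ f n → x ≤ₒ olim f
≤ₒ-olim ozero    f n _ = tt
≤ₒ-olim (osuc x) f n p = n , p
≤ₒ-olim (olim g) f n p = λ m → ≤ₒ-olim (g m) f n (p m)

≤ₒ-refl : ∀ x → x ≤ₒ x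
≤ₒ-refl ozero    = tt
≤ₒ-refl (osuc x) = ≤ₒ-refl x
≤ₒ-refl (olim f) = λ n → ≤ₒ-olim (f n) f n (≤ₒ-refl (f n))

f≤ₒolim : ∀ f n → f n ≤ₒ olim f
f≤ₒolim f n = ≤ₒ-olim (f n) f n (≤ₒ-refl (f n))

x<ₒosuc : ∀ x → x <ₒ osuc x
x<ₒosuc = ≤ₒ-refl

mutual
  <ₒ⇒≤ₒ : ∀ x y → x <ₒ y → x ≤ₒ y
  <ₒ⇒≤ₒ x (osuc y) p       = ≤ₒ-osucʳ x y p
  <ₒ⇒≤ₒ x (olim g) (n , p) = ≤ₒ-olim x g n (<ₒ⇒≤ₒ x (g n) p)

  ≤ₒ-osucʳ : ∀ x y → x ≤ₒ y → x ≤ₒ osuc y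
  ≤ₒ-osucʳ ozero    y p = tt
  ≤ₒ-osucʳ (osuc x) y p = <ₒ⇒≤ₒ x y p
  ≤ₒ-osucʳ (olim f) y p = λ n → ≤ₒ-osucʳ (f n) y (p n)

mutual
  ≤ₒ-trans : ∀ x y z → x ≤ₒ y → y ≤ₒ z → x ≤ₒ z
  ≤ₒ-trans ozero    y z p q = tt
  ≤ₒ-trans (osuc x) y z p q = <ₒ-≤ₒ-trans x y z p q
  ≤ₒ-trans (olim f) y z p q = λ n → ≤ₒ-trans (f n) y z (p n) q

  <ₒ-≤ₒ-trans : ∀ x y z → x <ₒ y → y ≤ₒ z → x <ₒ z
  <ₒ-≤ₒ-trans x (osuc y) z p       q = ≤ₒ-<ₒ-trans x y z p q
  <ₒ-≤ₒ-trans x (olim g) z (n , p) q = <ₒ-≤ₒ-trans x (g n) z p (q n)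

  ≤ₒ-<ₒ-trans : ∀ x y z → x ≤ₒ y → y <ₒ z → x <ₒ z
  ≤ₒ-<ₒ-trans x y (osuc z) p q       = ≤ₒ-trans x y z p q
  ≤ₒ-<ₒ-trans x y (olim h) p (n , q) = n , ≤ₒ-<ₒ-trans x y (h n) p q

<ₒ-trans : ∀ x y z → x <ₒ y → y <ₒ z → x <ₒ z
<ₒ-trans x y z p q = <ₒ-≤ₒ-trans x y z p (<ₒ⇒≤ₒ y z q)

<ₒ-acc : ∀ x {y} → y <ₒ x → Acc _<ₒ_ y
<ₒ-acc (osuc x) {y} p       = acc (λ {z} q → <ₒ-acc x (<ₒ-≤ₒ-trans z y x q p))
<ₒ-acc (olim f)     (n , p) = <ₒ-acc (f n) p

<ₒ-wellFounded : WellFounded _<ₒ_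
<ₒ-wellFounded x = acc (<ₒ-acc x)

<ₒ-irrefl : ∀ x → ¬ (x <ₒ x)
<ₒ-irrefl x = go (<ₒ-wellFounded x)
  where
  go : ∀ {x} → Acc _<ₒ_ x → ¬ (x <ₒ x)
  go (acc rs) p = go (rs p) p

<ₒ⇒≱ₒ : ∀ x y → x <ₒ y → ¬ (y ≤ₒ x)
<ₒ⇒≱ₒ x y p q = <ₒ-irrefl x (<ₒ-≤ₒ-trans x y x p q)

≈ₒ-refl : ∀ x → x ≈ₒ x
≈ₒ-refl x = ≤ₒ-refl x , ≤ₒ-refl x

≈ₒ-trans : ∀ x y z → x ≈ₒ y → y ≈ₒ z → x ≈ₒ z
≈ₒ-trans x y z (p , q) (r , s) = ≤ₒ-trans x y z p r , ≤ₒ-trans z y x s q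

module ≤ₒ-Reasoning where
  private
    ≤ₒ-isPreorder : IsPreorder _≈ₒ_ _≤ₒ_
    ≤ₒ-isPreorder = record
      { isEquivalence = record
        { refl = λ {x} → ≈ₒ-refl x ; sym = swap ; trans = λ {x} {y} {z} → ≈ₒ-trans x y z }
      ; reflexive     = proj₁
      ; trans         = λ {x} {y} {z} → ≤ₒ-trans x y z
      }

  open import Relation.Binary.Reasoning.Base.Triple ≤ₒ-isPreorder
    (λ {x} {y} p q → <ₒ⇒≱ₒ x y p (<ₒ⇒≤ₒ y x q))
    (λ {x} {y} {z} → <ₒ-trans x y z)
    ( (λ {x} {y} {y′} e p → <ₒ-≤ₒ-trans x y y′ p (proj₁ e))
    , (λ {x} {y} {y′} e p → ≤ₒ-<ₒ-trans y′ y x (proj₂ e) p))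
    (λ {x} {y} → <ₒ⇒≤ₒ x y)
    (λ {x} {y} {z} → <ₒ-≤ₒ-trans x y z)
    (λ {x} {y} {z} → ≤ₒ-<ₒ-trans x y z)
    public

open ≤ₒ-Reasoning

-- Ordinal arithmetic

olim-mono-≤ₒ : ∀ f g → (∀ n → f n ≤ₒ g n) → olim f ≤ₒ olim g
olim-mono-≤ₒ f g p n = ≤ₒ-olim (f n) g n (p n)

mutual
  +ₒ-monoʳ-≤ₒ : ∀ x y z → y ≤ₒ z → x +ₒ y ≤ₒ x +ₒ z
  +ₒ-monoʳ-≤ₒ x ozero    z p = x≤ₒx+ₒy x z
  +ₒ-monoʳ-≤ₒ x (osuc y) z p = +ₒ-monoʳ-<ₒ x y z p
  +ₒ-monoʳ-≤ₒ x (olim f) z p = λ n → +ₒ-monoʳ-≤ₒ x (f n) z (p n)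

  +ₒ-monoʳ-<ₒ : ∀ x y z → y <ₒ z → x +ₒ y <ₒ x +ₒ z
  +ₒ-monoʳ-<ₒ x y (osuc z) p       = +ₒ-monoʳ-≤ₒ x y z p
  +ₒ-monoʳ-<ₒ x y (olim h) (n , p) = n , +ₒ-monoʳ-<ₒ x y (h n) p

  x≤ₒx+ₒy : ∀ x y → x ≤ₒ x +ₒ y
  x≤ₒx+ₒy x ozero    = ≤ₒ-refl x
  x≤ₒx+ₒy x (osuc y) = ≤ₒ-osucʳ x (x +ₒ y) (x≤ₒx+ₒy x y)
  x≤ₒx+ₒy x (olim h) = ≤ₒ-olim x (λ n → x +ₒ h n) 0 (x≤ₒx+ₒy x (h 0))

x<ₒx+ₒy : ∀ x y → ozero <ₒ y → x <ₒ x +ₒ y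
x<ₒx+ₒy x y = +ₒ-monoʳ-<ₒ x ozero y

y≤ₒx+ₒy : ∀ x y → y ≤ₒ x +ₒ y
y≤ₒx+ₒy x ozero    = tt
y≤ₒx+ₒy x (osuc y) = y≤ₒx+ₒy x y
y≤ₒx+ₒy x (olim f) = λ n → ≤ₒ-olim (f n) (λ m → x +ₒ f m) n (y≤ₒx+ₒy x (f n))

+ₒ-monoˡ-≤ₒ : ∀ x x′ y → x ≤ₒ x′ → x +ₒ y ≤ₒ x′ +ₒ y
+ₒ-monoˡ-≤ₒ x x′ ozero    p = p
+ₒ-monoˡ-≤ₒ x x′ (osuc y) p = +ₒ-monoˡ-≤ₒ x x′ y p
+ₒ-monoˡ-≤ₒ x x′ (olim f) p =
  olim-mono-≤ₒ (λ n → x +ₒ f n) (λ n → x′ +ₒ f n) (λ n → +ₒ-monoˡ-≤ₒ x x′ (f n) p)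

+ₒ-mono-≤ₒ : ∀ x x′ y y′ → x ≤ₒ x′ → y ≤ₒ y′ → x +ₒ y ≤ₒ x′ +ₒ y′
+ₒ-mono-≤ₒ x x′ y y′ p q = begin
  x +ₒ y   ≤⟨ +ₒ-monoˡ-≤ₒ x x′ y p ⟩
  x′ +ₒ y  ≤⟨ +ₒ-monoʳ-≤ₒ x′ y y′ q ⟩
  x′ +ₒ y′ ∎

+ₒ-congˡ : ∀ x x′ y → x ≈ₒ x′ → x +ₒ y ≈ₒ x′ +ₒ y
+ₒ-congˡ x x′ y (p , q) = +ₒ-monoˡ-≤ₒ x x′ y p , +ₒ-monoˡ-≤ₒ x′ x y q

+ₒ-congʳ : ∀ x y y′ → y ≈ₒ y′ → x +ₒ y ≈ₒ x +ₒ y′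
+ₒ-congʳ x y y′ (p , q) = +ₒ-monoʳ-≤ₒ x y y′ p , +ₒ-monoʳ-≤ₒ x y′ y q

+ₒ-identityˡ : ∀ x → ozero +ₒ x ≈ₒ x
+ₒ-identityˡ ozero    = tt , tt
+ₒ-identityˡ (osuc x) = +ₒ-identityˡ x
+ₒ-identityˡ (olim f) =
  olim-mono-≤ₒ (λ n → ozero +ₒ f n) f (λ n → proj₁ (+ₒ-identityˡ (f n))) ,
  olim-mono-≤ₒ f (λ n → ozero +ₒ f n) (λ n → proj₂ (+ₒ-identityˡ (f n)))

infixl 30 _·ℕ_

_·ℕ_ : Ord → ℕ → Ord
x ·ℕ n = x ·ₒ fromℕₒ n

·ℕ-monoʳ-≤ₒ : ∀ x {m n} → m ℕ.≤ n → x ·ℕ m ≤ₒ x ·ℕ n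
·ℕ-monoʳ-≤ₒ x z≤n = tt
·ℕ-monoʳ-≤ₒ x {suc m} {suc n} (s≤s p) = +ₒ-monoˡ-≤ₒ (x ·ℕ m) (x ·ℕ n) x (·ℕ-monoʳ-≤ₒ x p)

·ℕ-monoˡ-≤ₒ : ∀ x y n → x ≤ₒ y → x ·ℕ n ≤ₒ y ·ℕ n
·ℕ-monoˡ-≤ₒ x y zero    p = tt
·ℕ-monoˡ-≤ₒ x y (suc n) p = +ₒ-mono-≤ₒ (x ·ℕ n) (y ·ℕ n) x y (·ℕ-monoˡ-≤ₒ x y n p) p

·ℕ-congˡ : ∀ x y n → x ≈ₒ y → x ·ℕ n ≈ₒ y ·ℕ n
·ℕ-congˡ x y n (p , q) = ·ℕ-monoˡ-≤ₒ x y n p , ·ℕ-monoˡ-≤ₒ y x n q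

·ℕ-identityʳ : ∀ x → x ·ℕ 1 ≈ₒ x
·ℕ-identityʳ = +ₒ-identityˡ

x≤ₒx·ℕn : ∀ x n → 1 ℕ.≤ n → x ≤ₒ x ·ℕ n
x≤ₒx·ℕn x n 1≤n = begin
  x       ≈⟨ ·ℕ-identityʳ x ⟨
  x ·ℕ 1  ≤⟨ ·ℕ-monoʳ-≤ₒ x 1≤n ⟩
  x ·ℕ n  ∎

x<ₒx·ℕ2 : ∀ x → ozero <ₒ x → x <ₒ x ·ℕ 2
x<ₒx·ℕ2 x 0<x = begin-strict
  x       ≈⟨ ·ℕ-identityʳ x ⟨
  x ·ℕ 1  <⟨ x<ₒx+ₒy (x ·ℕ 1) x 0<x ⟩
  x ·ℕ 2  ∎

ω^-positive : ∀ x → ozero <ₒ ω^ x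
ω^-positive ozero    = tt
ω^-positive (osuc x) = 1 , <ₒ-≤ₒ-trans ozero (ω^ x) (ozero +ₒ (ω^ x)) (ω^-positive x) (proj₂ (+ₒ-identityˡ (ω^ x)))
ω^-positive (olim g) = 0 , ω^-positive (g 0)

ω^<ₒω^osuc : ∀ x → ω^ x <ₒ ω^ osuc x
ω^<ₒω^osuc x = 2 , x<ₒx·ℕ2 (ω^ x) (ω^-positive x)

mutual
  ω^-mono-≤ₒ : ∀ x y → x ≤ₒ y → ω^ x ≤ₒ ω^ y
  ω^-mono-≤ₒ ozero    y        p = ω^-positive y
  ω^-mono-≤ₒ (olim f) y        p = λ n → ω^-mono-≤ₒ (f n) y (p n)
  ω^-mono-≤ₒ (osuc x) (osuc y) p = λ n → begin
    (ω^ x) ·ℕ n  ≤⟨ ·ℕ-monoˡ-≤ₒ (ω^ x) (ω^ y) n (ω^-mono-≤ₒ x y p) ⟩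
    (ω^ y) ·ℕ n  ≤⟨ f≤ₒolim (λ k → (ω^ y) ·ℕ k) n ⟩
    ω^ osuc y    ∎
  ω^-mono-≤ₒ (osuc x) (olim g) (m , p) = λ n →
    ≤ₒ-olim ((ω^ x) ·ℕ n) (λ k → ω^ g k) m (ω^-mono-≤ₒ (osuc x) (g m) p n)

  ω^-mono-<ₒ : ∀ x y → x <ₒ y → ω^ x <ₒ ω^ y
  ω^-mono-<ₒ x (osuc y) p = begin-strict
    ω^ x       ≤⟨ ω^-mono-≤ₒ x y p ⟩
    ω^ y       <⟨ ω^<ₒω^osuc y ⟩
    ω^ osuc y  ∎
  ω^-mono-<ₒ x (olim g) (n , p) = n , ω^-mono-<ₒ x (g n) p

ω^-cong : ∀ x y → x ≈ₒ y → ω^ x ≈ₒ ω^ y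
ω^-cong x y (p , q) = ω^-mono-≤ₒ x y p , ω^-mono-≤ₒ y x q

x≤ₒω^x : ∀ x → x ≤ₒ ω^ x
x≤ₒω^x ozero    = tt
x≤ₒω^x (osuc x) = ≤ₒ-<ₒ-trans x (ω^ x) (ω^ osuc x) (x≤ₒω^x x) (ω^<ₒω^osuc x)
x≤ₒω^x (olim f) = λ n → ≤ₒ-olim (f n) (λ k → ω^ f k) n (x≤ₒω^x (f n))

osuc≉limit : ∀ β γ → IsLimit γ → ¬ (osuc β ≈ₒ γ)
osuc≉limit β γ (_ , lim) (sβ≤γ , γ≤sβ) =
  <ₒ⇒≱ₒ (osuc β) γ (lim β (<ₒ-≤ₒ-trans β (osuc β) γ (x<ₒosuc β) sβ≤γ)) γ≤sβ

<ₒω^⇒<ₒω^osuc : ∀ ξ b → ξ <ₒ ω^ b → ξ ≤ₒ ozero ⊎ Σ Ord λ a → osuc a ≤ₒ b × ξ <ₒ ω^ osuc a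
<ₒω^⇒<ₒω^osuc ξ ozero    ξ<1 = inj₁ ξ<1
<ₒω^⇒<ₒω^osuc ξ (osuc a) ξ<  = inj₂ (a , ≤ₒ-refl (osuc a) , ξ<)
<ₒω^⇒<ₒω^osuc ξ (olim g) (n , ξ<) with <ₒω^⇒<ₒω^osuc ξ (g n) ξ<
... | inj₁ ξ≤0            = inj₁ ξ≤0
... | inj₂ (a , a<gn , q) = inj₂ (a , ≤ₒ-olim (osuc a) g n a<gn , q)

-- Cantor normal forms

IsCNF : List (Ord × ℕ) → Set
IsCNF L = Linked (λ t u → proj₁ u <ₒ proj₁ t) L × All (λ t → 1 ℕ.≤ proj₂ t) L

IsCNF-tail : ∀ {t ts} → IsCNF (t ∷ ts) → IsCNF ts
IsCNF-tail (lk , _ ∷ cs) = Linked.tail lk , cs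

cnfVal-tail<ₒω^ : ∀ a p ts → IsCNF ((a , p) ∷ ts) → cnfVal ts <ₒ ω^ a
cnfVal-tail<ₒω^ a p []             _ = ω^-positive a
cnfVal-tail<ₒω^ a p ((e , c) ∷ ts) v@(e<a ∷ _ , _) = begin-strict
  (ω^ e) ·ℕ c +ₒ cnfVal ts  <⟨ +ₒ-monoʳ-<ₒ ((ω^ e) ·ℕ c) (cnfVal ts) (ω^ e) ts<ω^e ⟩
  (ω^ e) ·ℕ suc c           ≤⟨ f≤ₒolim (λ n → (ω^ e) ·ℕ n) (suc c) ⟩
  ω^ osuc e                 ≤⟨ ω^-mono-≤ₒ (osuc e) a e<a ⟩
  ω^ a                      ∎
  where
  ts<ω^e : cnfVal ts <ₒ ω^ e
  ts<ω^e = cnfVal-tail<ₒω^ e c ts (IsCNF-tail v)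

cnfVal<ₒω^·ℕsuc : ∀ a p ts → IsCNF ((a , p) ∷ ts) → cnfVal ((a , p) ∷ ts) <ₒ (ω^ a) ·ℕ suc p
cnfVal<ₒω^·ℕsuc a p ts v = +ₒ-monoʳ-<ₒ ((ω^ a) ·ℕ p) (cnfVal ts) (ω^ a) (cnfVal-tail<ₒω^ a p ts v)

ω^≤ₒcnfVal : ∀ a p ts → IsCNF ((a , p) ∷ ts) → ω^ a ≤ₒ cnfVal ((a , p) ∷ ts)
ω^≤ₒcnfVal a p ts (_ , 1≤p ∷ _) = begin
  ω^ a                      ≤⟨ x≤ₒx·ℕn (ω^ a) p 1≤p ⟩
  (ω^ a) ·ℕ p               ≤⟨ x≤ₒx+ₒy ((ω^ a) ·ℕ p) (cnfVal ts) ⟩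
  (ω^ a) ·ℕ p +ₒ cnfVal ts  ∎

cnfVal-positive : ∀ a p ts → IsCNF ((a , p) ∷ ts) → ozero <ₒ cnfVal ((a , p) ∷ ts)
cnfVal-positive a p ts v = <ₒ-≤ₒ-trans ozero (ω^ a) _ (ω^-positive a) (ω^≤ₒcnfVal a p ts v)

cnfVal-<ₒ-exponent : ∀ a p ts a′ p′ ts′ → IsCNF ((a , p) ∷ ts) → IsCNF ((a′ , p′) ∷ ts′) →
                     a′ <ₒ a → cnfVal ((a′ , p′) ∷ ts′) <ₒ cnfVal ((a , p) ∷ ts)
cnfVal-<ₒ-exponent a p ts a′ p′ ts′ v v′ a′<a = begin-strict
  cnfVal ((a′ , p′) ∷ ts′)  <⟨ cnfVal<ₒω^·ℕsuc a′ p′ ts′ v′ ⟩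
  (ω^ a′) ·ℕ suc p′         ≤⟨ f≤ₒolim (λ n → (ω^ a′) ·ℕ n) (suc p′) ⟩
  ω^ osuc a′                ≤⟨ ω^-mono-≤ₒ (osuc a′) a a′<a ⟩
  ω^ a                      ≤⟨ ω^≤ₒcnfVal a p ts v ⟩
  cnfVal ((a , p) ∷ ts)     ∎

cnfVal-<ₒ-coefficient : ∀ a p ts a′ p′ ts′ → IsCNF ((a , p) ∷ ts) → a ≤ₒ a′ → p ℕ.< p′ →
                        cnfVal ((a , p) ∷ ts) <ₒ cnfVal ((a′ , p′) ∷ ts′)
cnfVal-<ₒ-coefficient a p ts a′ p′ ts′ v a≤a′ p<p′ = begin-strict
  cnfVal ((a , p) ∷ ts)       <⟨ cnfVal<ₒω^·ℕsuc a p ts v ⟩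
  (ω^ a) ·ℕ suc p             ≤⟨ ·ℕ-monoʳ-≤ₒ (ω^ a) p<p′ ⟩
  (ω^ a) ·ℕ p′                ≤⟨ ·ℕ-monoˡ-≤ₒ (ω^ a) (ω^ a′) p′ (ω^-mono-≤ₒ a a′ a≤a′) ⟩
  (ω^ a′) ·ℕ p′               ≤⟨ x≤ₒx+ₒy ((ω^ a′) ·ℕ p′) (cnfVal ts′) ⟩
  cnfVal ((a′ , p′) ∷ ts′)    ∎

SameCNF : List (Ord × ℕ) → List (Ord × ℕ) → Set
SameCNF = Pointwise (λ t u → proj₁ t ≈ₒ proj₁ u × proj₂ t ≡ proj₂ u)

-- The side conditions of the clause a-cnf of 𝒜.
ProperCNF : Ord → ℕ → List (Ord × ℕ) → Set
ProperCNF a p ts = IsCNF ((a , p) ∷ ts) × All (λ t → ozero <ₒ proj₁ t) ((a , p) ∷ ts) × (1 ℕ.< p ⊎ NE ts)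

IsCNF-exponents≤ : ∀ a p ts → IsCNF ((a , p) ∷ ts) → All (λ t → proj₁ t ≤ₒ a) ((a , p) ∷ ts)
IsCNF-exponents≤ a p []             _ = ≤ₒ-refl a ∷ []
IsCNF-exponents≤ a p ((e , c) ∷ ts) v@(e<a ∷ _ , _) =
  ≤ₒ-refl a ∷ All.map (λ {t} t≤e → ≤ₒ-trans (proj₁ t) e a t≤e (<ₒ⇒≤ₒ e a e<a))
                      (IsCNF-exponents≤ e c ts (IsCNF-tail v))

ω^<ₒproperCNF : ∀ a p ts → ProperCNF a p ts → ω^ a <ₒ cnfVal ((a , p) ∷ ts)
ω^<ₒproperCNF a p ts (v , _ , inj₁ 2≤p) = begin-strict
  ω^ a                       <⟨ x<ₒx·ℕ2 (ω^ a) (ω^-positive a) ⟩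
  (ω^ a) ·ℕ 2                ≤⟨ ·ℕ-monoʳ-≤ₒ (ω^ a) 2≤p ⟩
  (ω^ a) ·ℕ p                ≤⟨ x≤ₒx+ₒy ((ω^ a) ·ℕ p) (cnfVal ts) ⟩
  cnfVal ((a , p) ∷ ts)      ∎
ω^<ₒproperCNF a p ts@((e , c) ∷ ts′) (v@(_ , 1≤p ∷ _) , _ , inj₂ _) = begin-strict
  ω^ a                       ≤⟨ x≤ₒx·ℕn (ω^ a) p 1≤p ⟩
  (ω^ a) ·ℕ p                <⟨ x<ₒx+ₒy ((ω^ a) ·ℕ p) (cnfVal ts) (cnfVal-positive e c ts′ (IsCNF-tail v)) ⟩
  cnfVal ((a , p) ∷ ts)      ∎
ω^<ₒproperCNF a p [] (_ , _ , inj₂ []≢[]) = ⊥-elim ([]≢[] refl)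

expand-NE : ∀ a p ts → 1 ℕ.≤ p → NE (expand ((a , p) ∷ ts))
expand-NE a (suc p) ts _ rev≡[]
  with Listₚ.reverse-injective {x = concatMap (λ t → replicate (proj₂ t) (proj₁ t)) ((a , suc p) ∷ ts)} {y = []} rev≡[]
... | ()

All-expand : ∀ {Q : Ord → Set} L → All (Q ∘ proj₁) L → All Q (expand L)
All-expand L qs = All-resp-↭ (↭-sym (↭-reverse _)) (Allₚ.concat⁺ (Allₚ.map⁺ (All.map (Allₚ.replicate⁺ _) qs)))

expand-cong : ∀ L L′ → SameCNF L L′ → Pointwise _≈ₒ_ (expand L) (expand L′)
expand-cong L L′ same = Pointwise.reverse⁺ (terms-cong same)
  where
  terms : List (Ord × ℕ) → List Ord
  terms = concatMap (λ t → replicate (proj₂ t) (proj₁ t))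
  terms-cong : ∀ {L L′} → SameCNF L L′ → Pointwise _≈ₒ_ (terms L) (terms L′)
  terms-cong [] = []
  terms-cong {(_ , c) ∷ _} {(_ , .c) ∷ _} ((e≈e′ , refl) ∷ same) =
    Pointwise.++⁺ (Pointwise.replicate⁺ e≈e′ c) (terms-cong same)

module Classical (em : ExcludedMiddle 0ℓ) where

  ≤ₒ⊎>ₒ : ∀ x y → x ≤ₒ y ⊎ y <ₒ x
  ≤ₒ⊎>ₒ ozero    y = inj₁ tt
  ≤ₒ⊎>ₒ (osuc x) y with ≤ₒ⊎>ₒ y x
  ... | inj₁ y≤x = inj₂ y≤x
  ... | inj₂ x<y = inj₁ x<y
  ≤ₒ⊎>ₒ (olim f) y with em {Σ ℕ λ n → ¬ (f n ≤ₒ y)}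
  ... | no ∄n = inj₁ λ n → em⇒dne em λ fn≰y → ∄n (n , fn≰y)
  ... | yes (n , fn≰y) with ≤ₒ⊎>ₒ (f n) y
  ...   | inj₁ fn≤y = ⊥-elim (fn≰y fn≤y)
  ...   | inj₂ y<fn = inj₂ (n , y<fn)

  ≮ₒ⇒≥ₒ : ∀ x y → ¬ (y <ₒ x) → x ≤ₒ y
  ≮ₒ⇒≥ₒ x y y≮x with ≤ₒ⊎>ₒ x y
  ... | inj₁ x≤y = x≤y
  ... | inj₂ y<x = ⊥-elim (y≮x y<x)

  ≰ₒ⇒>ₒ : ∀ x y → ¬ (x ≤ₒ y) → y <ₒ x
  ≰ₒ⇒>ₒ x y x≰y with ≤ₒ⊎>ₒ x y
  ... | inj₁ x≤y = ⊥-elim (x≰y x≤y)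
  ... | inj₂ y<x = y<x

  <ₒ-minimal : (Q : Ord → Set) → ∀ x → Q x → Σ Ord λ y → Q y × (∀ z → z <ₒ y → ¬ Q z)
  <ₒ-minimal Q x = go x (<ₒ-wellFounded x)
    where
    go : ∀ x → Acc _<ₒ_ x → Q x → Σ Ord λ y → Q y × (∀ z → z <ₒ y → ¬ Q z)
    go x (acc rs) qx with em {Σ Ord λ z → z <ₒ x × Q z}
    ... | yes (z , z<x , qz) = go z (rs z<x) qz
    ... | no ∄z              = x , qx , λ z z<x qz → ∄z (z , z<x , qz)

  ≤ₒ⇒∃[δ]x+ₒδ≈ₒy : ∀ x y → x ≤ₒ y → Σ Ord λ δ → x +ₒ δ ≈ₒ y
  ≤ₒ⇒∃[δ]x+ₒδ≈ₒy x y x≤y with <ₒ-minimal (λ d → y ≤ₒ x +ₒ d) y (y≤ₒx+ₒy x y)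
  ... | δ , y≤x+δ , minimal = δ , x+δ≤y x≤y δ (λ d d<δ → ≰ₒ⇒>ₒ y (x +ₒ d) (minimal d d<δ)) , y≤x+δ
    where
    x+δ≤y : x ≤ₒ y → ∀ δ → (∀ d → d <ₒ δ → x +ₒ d <ₒ y) → x +ₒ δ ≤ₒ y
    x+δ≤y x≤y ozero    below = x≤y
    x+δ≤y x≤y (osuc δ) below = below δ (x<ₒosuc δ)
    x+δ≤y x≤y (olim g) below = λ n → x+δ≤y x≤y (g n) (λ d d<gn → below d (n , d<gn))

  +ₒ-cancelˡ-≈ₒ : ∀ x y z → x +ₒ y ≈ₒ x +ₒ z → y ≈ₒ z
  +ₒ-cancelˡ-≈ₒ x y z (p , q) =
    ≮ₒ⇒≥ₒ y z (λ z<y → <ₒ⇒≱ₒ (x +ₒ z) (x +ₒ y) (+ₒ-monoʳ-<ₒ x z y z<y) p) ,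
    ≮ₒ⇒≥ₒ z y (λ y<z → <ₒ⇒≱ₒ (x +ₒ y) (x +ₒ z) (+ₒ-monoʳ-<ₒ x y z y<z) q)

  ω^-injective : ∀ x y → ω^ x ≈ₒ ω^ y → x ≈ₒ y
  ω^-injective x y (p , q) =
    ≮ₒ⇒≥ₒ x y (λ y<x → <ₒ⇒≱ₒ (ω^ y) (ω^ x) (ω^-mono-<ₒ y x y<x) p) ,
    ≮ₒ⇒≥ₒ y x (λ x<y → <ₒ⇒≱ₒ (ω^ x) (ω^ y) (ω^-mono-<ₒ x y x<y) q)

  ω^-isLimit : ∀ x → ozero <ₒ x → IsLimit (ω^ x)
  ω^-isLimit (osuc x) _ = ω^-positive (osuc x) , λ where
    β (n , β<) → suc n , ≤ₒ-<ₒ-trans (osuc β) ((ω^ x) ·ℕ n) ((ω^ x) ·ℕ suc n) β<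
                           (x<ₒx+ₒy ((ω^ x) ·ℕ n) (ω^ x) (ω^-positive x))
  ω^-isLimit (olim g) (m , 0<gm) = ω^-positive (olim g) , λ β (n , β<) → succ-below β n β<
    where
    succ-below : ∀ β n → β <ₒ ω^ g n → osuc β <ₒ ω^ olim g
    succ-below β n β< with ≤ₒ⊎>ₒ (g n) ozero
    ... | inj₂ 0<gn = n , proj₂ (ω^-isLimit (g n) 0<gn) β β<
    ... | inj₁ gn≤0 = m , ≤ₒ-<ₒ-trans (osuc β) (osuc ozero) (ω^ g m)
                            (<ₒ-≤ₒ-trans β (ω^ g n) (osuc ozero) β< (ω^-mono-≤ₒ (g n) ozero gn≤0))
                            (proj₂ (ω^-isLimit (g m) 0<gm) ozero (ω^-positive (g m)))

  +ₒ-isLimit : ∀ x γ → IsLimit γ → IsLimit (x +ₒ γ)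
  +ₒ-isLimit x γ (0<γ , lim) = ≤ₒ-<ₒ-trans ozero x (x +ₒ γ) tt x<x+γ , succ-below
    where
    x<x+γ : x <ₒ x +ₒ γ
    x<x+γ = x<ₒx+ₒy x γ 0<γ
    succ-below : ∀ β → β <ₒ x +ₒ γ → osuc β <ₒ x +ₒ γ
    succ-below β β< with ≤ₒ⊎>ₒ x β
    ... | inj₂ β<x = ≤ₒ-<ₒ-trans (osuc β) x (x +ₒ γ) β<x x<x+γ
    ... | inj₁ x≤β with ≤ₒ⇒∃[δ]x+ₒδ≈ₒy x β x≤β
    ...   | δ , x+δ≈β with ≤ₒ⊎>ₒ γ δ
    ...     | inj₁ γ≤δ = ⊥-elim (<ₒ⇒≱ₒ β (x +ₒ γ) β<
                (≤ₒ-trans (x +ₒ γ) (x +ₒ δ) β (+ₒ-monoʳ-≤ₒ x γ δ γ≤δ) (proj₁ x+δ≈β)))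
    ...     | inj₂ δ<γ = begin-strict
      osuc β         ≤⟨ proj₂ x+δ≈β ⟩
      osuc (x +ₒ δ)  <⟨ +ₒ-monoʳ-<ₒ x (osuc δ) γ (lim δ δ<γ) ⟩
      x +ₒ γ         ∎

  cnf-unique : ∀ L L′ → IsCNF L → IsCNF L′ → cnfVal L ≈ₒ cnfVal L′ → SameCNF L L′
  cnf-unique [] [] _ _ _ = []
  cnf-unique [] L′@((a , p) ∷ ts) _ v′ (_ , L′≤0) =
    ⊥-elim (<ₒ⇒≱ₒ ozero (cnfVal L′) (cnfVal-positive a p ts v′) L′≤0)
  cnf-unique L@((a , p) ∷ ts) [] v _ (L≤0 , _) =
    ⊥-elim (<ₒ⇒≱ₒ ozero (cnfVal L) (cnfVal-positive a p ts v) L≤0)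
  cnf-unique L@((a , p) ∷ ts) L′@((a′ , p′) ∷ ts′) v v′ L≈L′@(L≤L′ , L′≤L) =
    (a≈a′ , p≡p′) ∷ cnf-unique ts ts′ (IsCNF-tail v) (IsCNF-tail v′)
                      (+ₒ-cancelˡ-≈ₒ ((ω^ a) ·ℕ p) (cnfVal ts) (cnfVal ts′) same-head)
    where
    a≈a′ : a ≈ₒ a′
    a≈a′ = ≮ₒ⇒≥ₒ a a′ (λ a′<a → <ₒ⇒≱ₒ (cnfVal L′) (cnfVal L) (cnfVal-<ₒ-exponent a p ts a′ p′ ts′ v v′ a′<a) L≤L′)
         , ≮ₒ⇒≥ₒ a′ a (λ a<a′ → <ₒ⇒≱ₒ (cnfVal L) (cnfVal L′) (cnfVal-<ₒ-exponent a′ p′ ts′ a p ts v′ v a<a′) L′≤L)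
    p≡p′ : p ≡ p′
    p≡p′ with ℕ.<-cmp p p′
    ... | tri< p<p′ _ _ =
      ⊥-elim (<ₒ⇒≱ₒ (cnfVal L) (cnfVal L′) (cnfVal-<ₒ-coefficient a p ts a′ p′ ts′ v (proj₁ a≈a′) p<p′) L′≤L)
    ... | tri≈ _ p≡p′ _ = p≡p′
    ... | tri> _ _ p′<p =
      ⊥-elim (<ₒ⇒≱ₒ (cnfVal L′) (cnfVal L) (cnfVal-<ₒ-coefficient a′ p′ ts′ a p ts v′ (proj₂ a≈a′) p′<p) L≤L′)
    same-head : (ω^ a) ·ℕ p +ₒ cnfVal ts ≈ₒ (ω^ a) ·ℕ p +ₒ cnfVal ts′
    same-head = begin-equality
      (ω^ a) ·ℕ p +ₒ cnfVal ts     ≈⟨ L≈L′ ⟩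
      (ω^ a′) ·ℕ p′ +ₒ cnfVal ts′  ≡⟨ cong (λ n → (ω^ a′) ·ℕ n +ₒ cnfVal ts′) p≡p′ ⟨
      (ω^ a′) ·ℕ p +ₒ cnfVal ts′   ≈⟨ +ₒ-congˡ ((ω^ a) ·ℕ p) ((ω^ a′) ·ℕ p) (cnfVal ts′) leading≈ ⟨
      (ω^ a) ·ℕ p +ₒ cnfVal ts′    ∎
      where
      leading≈ : (ω^ a) ·ℕ p ≈ₒ (ω^ a′) ·ℕ p
      leading≈ = ·ℕ-congˡ (ω^ a) (ω^ a′) p (ω^-cong a a′ a≈a′)

  ·ℕ-floor : ∀ ξ x n → ξ <ₒ x ·ℕ n → Σ ℕ λ p → x ·ℕ p ≤ₒ ξ × ξ <ₒ x ·ℕ suc p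
  ·ℕ-floor ξ x (suc n) ξ< with ≤ₒ⊎>ₒ (x ·ℕ n) ξ
  ... | inj₁ x·n≤ξ = n , x·n≤ξ , ξ<
  ... | inj₂ ξ<x·n = ·ℕ-floor ξ x n ξ<x·n

  leading-term : ∀ ξ → ozero <ₒ ξ →
                 Σ Ord λ a → Σ ℕ λ p → 1 ℕ.≤ p × (ω^ a) ·ℕ p ≤ₒ ξ × ξ <ₒ (ω^ a) ·ℕ suc p
  leading-term ξ 0<ξ
    with <ₒ-minimal (λ b → ξ <ₒ ω^ b) (osuc ξ) (≤ₒ-<ₒ-trans ξ (ω^ ξ) (ω^ osuc ξ) (x≤ₒω^x ξ) (ω^<ₒω^osuc ξ))
  ... | b , ξ<ω^b , minimal with <ₒω^⇒<ₒω^osuc ξ b ξ<ω^b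
  ...   | inj₁ ξ≤0 = ⊥-elim (<ₒ⇒≱ₒ ozero ξ 0<ξ ξ≤0)
  ...   | inj₂ (a , a<b , (n , ξ<ω^a·n)) with ·ℕ-floor ξ (ω^ a) n ξ<ω^a·n
  ...     | zero  , _     , ξ<ω^a·1 =
    ⊥-elim (minimal a a<b (<ₒ-≤ₒ-trans ξ ((ω^ a) ·ℕ 1) (ω^ a) ξ<ω^a·1 (proj₁ (·ℕ-identityʳ (ω^ a)))))
  ...     | suc p , lower , upper   = a , suc p , s≤s z≤n , lower , upper

  cantor-division : ∀ ξ → ozero <ₒ ξ →
                    Σ Ord λ a → Σ ℕ λ p → Σ Ord λ ρ → 1 ℕ.≤ p × ρ <ₒ ω^ a × (ω^ a) ·ℕ p +ₒ ρ ≈ₒ ξ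
  cantor-division ξ 0<ξ with leading-term ξ 0<ξ
  ... | a , p , 1≤p , lower , upper with ≤ₒ⇒∃[δ]x+ₒδ≈ₒy ((ω^ a) ·ℕ p) ξ lower
  ...   | ρ , head+ρ≈ξ = a , p , ρ , 1≤p , ρ<ω^a , head+ρ≈ξ
    where
    ρ<ω^a : ρ <ₒ ω^ a
    ρ<ω^a = ≰ₒ⇒>ₒ (ω^ a) ρ λ ω^a≤ρ → <ₒ⇒≱ₒ ξ ((ω^ a) ·ℕ suc p) upper (begin
      (ω^ a) ·ℕ suc p     ≤⟨ +ₒ-monoʳ-≤ₒ ((ω^ a) ·ℕ p) (ω^ a) ρ ω^a≤ρ ⟩
      (ω^ a) ·ℕ p +ₒ ρ    ≈⟨ head+ρ≈ξ ⟩
      ξ                   ∎)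

  IsCNF-∷ : ∀ a p L → 1 ℕ.≤ p → IsCNF L → cnfVal L <ₒ ω^ a → IsCNF ((a , p) ∷ L)
  IsCNF-∷ a p []             1≤p _            _ = [-] , 1≤p ∷ []
  IsCNF-∷ a p L@((e , c) ∷ _) 1≤p v@(lk , cs) L<ω^a = e<a ∷ lk , 1≤p ∷ cs
    where
    e<a : e <ₒ a
    e<a = ≰ₒ⇒>ₒ a e λ a≤e → <ₒ⇒≱ₒ (cnfVal L) (ω^ a) L<ω^a
            (≤ₒ-trans (ω^ a) (ω^ e) (cnfVal L) (ω^-mono-≤ₒ a e a≤e) (ω^≤ₒcnfVal e c _ v))

  cnf-exists : ∀ ξ → Σ (List (Ord × ℕ)) λ L → IsCNF L × ξ ≈ₒ cnfVal L
  cnf-exists ξ = go ξ (<ₒ-wellFounded ξ)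
    where
    go : ∀ ξ → Acc _<ₒ_ ξ → Σ (List (Ord × ℕ)) λ L → IsCNF L × ξ ≈ₒ cnfVal L
    go ξ (acc rs) with ≤ₒ⊎>ₒ ξ ozero
    ... | inj₁ ξ≤0 = [] , ([] , []) , ξ≤0 , tt
    ... | inj₂ 0<ξ with cantor-division ξ 0<ξ
    ...   | a , p , ρ , 1≤p , ρ<ω^a , head+ρ≈ξ with go ρ (rs ρ<ξ)
      where
      ρ<ξ : ρ <ₒ ξ
      ρ<ξ = begin-strict
        ρ                 <⟨ ρ<ω^a ⟩
        ω^ a              ≤⟨ x≤ₒx·ℕn (ω^ a) p 1≤p ⟩
        (ω^ a) ·ℕ p       ≤⟨ x≤ₒx+ₒy ((ω^ a) ·ℕ p) ρ ⟩
        (ω^ a) ·ℕ p +ₒ ρ  ≈⟨ head+ρ≈ξ ⟩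
        ξ                 ∎
    ...     | L , v , ρ≈L =
      (a , p) ∷ L ,
      IsCNF-∷ a p L 1≤p v (≤ₒ-<ₒ-trans (cnfVal L) ρ (ω^ a) (proj₂ ρ≈L) ρ<ω^a) ,
      (begin-equality
        ξ                         ≈⟨ head+ρ≈ξ ⟨
        (ω^ a) ·ℕ p +ₒ ρ          ≈⟨ +ₒ-congʳ ((ω^ a) ·ℕ p) ρ (cnfVal L) ρ≈L ⟩
        (ω^ a) ·ℕ p +ₒ cnfVal L   ∎)

  cnf-positive⊎successor : ∀ L → IsCNF L → All (λ t → ozero <ₒ proj₁ t) L ⊎ Σ Ord λ ζ → cnfVal L ≈ₒ osuc ζ
  cnf-positive⊎successor [] _ = inj₁ []
  cnf-positive⊎successor ((e , c) ∷ ts) v with cnf-positive⊎successor ts (IsCNF-tail v)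
  ... | inj₂ (ζ , ts≈sζ) =
    inj₂ ((ω^ e) ·ℕ c +ₒ ζ , +ₒ-congʳ ((ω^ e) ·ℕ c) (cnfVal ts) (osuc ζ) ts≈sζ)
  ... | inj₁ ts-positive with ≤ₒ⊎>ₒ e ozero
  ...   | inj₂ 0<e = inj₁ (0<e ∷ ts-positive)
  ...   | inj₁ e≤0 = inj₂ (finite c ts v ts-positive)
    where
    finite : ∀ c ts → IsCNF ((e , c) ∷ ts) → All (λ t → ozero <ₒ proj₁ t) ts →
             Σ Ord λ ζ → cnfVal ((e , c) ∷ ts) ≈ₒ osuc ζ
    finite (suc c′) [] _ _ = (ω^ e) ·ℕ c′ ,
      +ₒ-congʳ ((ω^ e) ·ℕ c′) (ω^ e) (osuc ozero) (ω^-cong e ozero (e≤0 , tt))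
    finite zero [] (_ , () ∷ _) _
    finite c ((e′ , _) ∷ _) (e′<e ∷ _ , _) (0<e′ ∷ _) =
      ⊥-elim (<ₒ⇒≱ₒ ozero e (<ₒ-trans ozero e′ e 0<e′ e′<e) e≤0)

  cnfVal-isLimit : ∀ a p ts → IsCNF ((a , p) ∷ ts) → All (λ t → ozero <ₒ proj₁ t) ((a , p) ∷ ts) →
                   IsLimit (cnfVal ((a , p) ∷ ts))
  cnfVal-isLimit a zero    []             (_ , () ∷ _) _
  cnfVal-isLimit a (suc p) []             _ (0<a ∷ _) = +ₒ-isLimit ((ω^ a) ·ℕ p) (ω^ a) (ω^-isLimit a 0<a)
  cnfVal-isLimit a p       ((e , c) ∷ ts) v (_ ∷ positive) =
    +ₒ-isLimit ((ω^ a) ·ℕ p) (cnfVal ((e , c) ∷ ts)) (cnfVal-isLimit e c ts (IsCNF-tail v) positive)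

  ω^≉properCNF : ∀ x a p ts → ProperCNF a p ts → ¬ (ω^ x ≈ₒ cnfVal ((a , p) ∷ ts))
  ω^≉properCNF x a p ts (v , _ , proper) ω^x≈ with cnf-unique ((x , 1) ∷ []) ((a , p) ∷ ts) ([-] , s≤s z≤n ∷ []) v
    (≈ₒ-trans ((ω^ x) ·ℕ 1) (ω^ x) (cnfVal ((a , p) ∷ ts)) (·ℕ-identityʳ (ω^ x)) ω^x≈)
  ω^≉properCNF x a .1 .[] (_ , _ , inj₁ (s≤s ())) _ | (_ , refl) ∷ []
  ω^≉properCNF x a .1 .[] (_ , _ , inj₂ ts≢[]) _ | (_ , refl) ∷ [] = ts≢[] refl

  ω^osuc≉ω^limit : ∀ β γ → IsLimit γ → ¬ (ω^ osuc β ≈ₒ ω^ γ)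
  ω^osuc≉ω^limit β γ l ω^sβ≈ω^γ = osuc≉limit β γ l (ω^-injective (osuc β) γ ω^sβ≈ω^γ)

  -- The cases distinguished by the clauses defining 𝒜.
  data Form (ξ : Ord) : Set where
    form-zero    : ξ ≈ₒ ozero → Form ξ
    form-suc     : ∀ ζ → ξ ≈ₒ osuc ζ → Form ξ
    form-pow-suc : ∀ β → ξ ≈ₒ ω^ osuc β → Form ξ
    form-pow-lim : ∀ γ → IsLimit γ → ξ ≈ₒ ω^ γ → Form ξ
    form-cnf     : ∀ a p ts → ProperCNF a p ts → ξ ≈ₒ cnfVal ((a , p) ∷ ts) → Form ξ

  ω^-form : ∀ ξ a → ozero <ₒ a → ξ ≈ₒ ω^ a → Form ξ
  ω^-form ξ a 0<a ξ≈ω^a with em {Σ Ord λ β → a ≈ₒ osuc β}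
  ... | yes (β , a≈sβ) = form-pow-suc β (≈ₒ-trans ξ (ω^ a) (ω^ osuc β) ξ≈ω^a (ω^-cong a (osuc β) a≈sβ))
  ... | no ¬succ       = form-pow-lim a (0<a , succ-below) ξ≈ω^a
    where
    succ-below : ∀ β → β <ₒ a → osuc β <ₒ a
    succ-below β β<a = ≰ₒ⇒>ₒ a (osuc β) λ a≤sβ → ¬succ (β , a≤sβ , β<a)

  positive-cnf-form : ∀ ξ a p ts → IsCNF ((a , p) ∷ ts) → All (λ t → ozero <ₒ proj₁ t) ((a , p) ∷ ts) →
                      ξ ≈ₒ cnfVal ((a , p) ∷ ts) → Form ξ
  positive-cnf-form ξ a (suc (suc p)) ts v positive ξ≈ =
    form-cnf a (suc (suc p)) ts (v , positive , inj₁ (s≤s (s≤s z≤n))) ξ≈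
  positive-cnf-form ξ a 1 ts@(_ ∷ _)  v positive ξ≈ = form-cnf a 1 ts (v , positive , inj₂ λ ()) ξ≈
  positive-cnf-form ξ a 1 [] _ (0<a ∷ _) ξ≈ =
    ω^-form ξ a 0<a (≈ₒ-trans ξ ((ω^ a) ·ℕ 1) (ω^ a) ξ≈ (·ℕ-identityʳ (ω^ a)))
  positive-cnf-form ξ a 0 ts (_ , () ∷ _) _ _

  form : ∀ ξ → Form ξ
  form ξ with cnf-exists ξ
  ... | [] , _ , ξ≈0 = form-zero ξ≈0
  ... | L@((a , p) ∷ ts) , v , ξ≈L with em {Σ Ord λ ζ → ξ ≈ₒ osuc ζ}
  ...   | yes (ζ , ξ≈sζ) = form-suc ζ ξ≈sζ
  ...   | no ¬succ with cnf-positive⊎successor L v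
  ...     | inj₁ positive   = positive-cnf-form ξ a p ts v positive ξ≈L
  ...     | inj₂ (ζ , L≈sζ) = ⊥-elim (¬succ (ζ , ≈ₒ-trans ξ (cnfVal L) (osuc ζ) ξ≈L L≈sζ))

-- Finite sets and disjoint collections

stepwise⇒monotone : ∀ {A : Set} {R : A → A → Set} → Transitive R → (f : ℕ → A) →
                    (∀ n → R (f n) (f (suc n))) → ∀ {i j} → i ℕ.< j → R (f i) (f j)
stepwise⇒monotone {R = R} trans f step {i} {suc j} i<1+j with ℕₚ.m<1+n⇒m<n∨m≡n i<1+j
... | inj₁ i<j  = trans {_} {f j} (stepwise⇒monotone {R = R} trans f step i<j) (step j)
... | inj₂ refl = step i

All-minL : ∀ {P : ℕ → Set} {xs} → NE xs → All P xs → P (minL xs)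
All-minL {xs = []}    xs≢[] _       = ⊥-elim (xs≢[] refl)
All-minL {xs = _ ∷ _} _     (px ∷ _) = px

++-NE : ∀ {A : Set} {xs ys : List A} → NE xs → NE (xs ++ ys)
++-NE {xs = []}    []≢[] = ⊥-elim ([]≢[] refl)
++-NE {xs = _ ∷ _} _     = λ ()

concat-NE : ∀ {ss : List (List ℕ)} → NE ss → All NE ss → NE (concat ss)
concat-NE {[]}    []≢[] _          = ⊥-elim ([]≢[] refl)
concat-NE {s ∷ _} _     (s≢[] ∷ _) = ++-NE {xs = s} s≢[]

Pointwise-NE : ∀ {A B : Set} {R : A → B → Set} {xs ys} → Pointwise R xs ys → NE xs → NE ys
Pointwise-NE []      []≢[] = ⊥-elim ([]≢[] refl)
Pointwise-NE (_ ∷ _) _     = λ ()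

Pointwise-replicate⁻ : ∀ {A B : Set} {R : A → B → Set} n {x ys} →
                       Pointwise R (replicate n x) ys → All (R x) ys × length ys ≡ n
Pointwise-replicate⁻ zero    []         = [] , refl
Pointwise-replicate⁻ (suc n) (r ∷ rs) with Pointwise-replicate⁻ n rs
... | all , len = r ∷ all , cong suc len

minL-applyUpTo : ∀ u K → NE (applyUpTo u K) → minL (applyUpTo u K) ≡ u 0
minL-applyUpTo u zero    []≢[] = ⊥-elim ([]≢[] refl)
minL-applyUpTo u (suc K) _     = refl

_≪_ : List ℕ → List ℕ → Set
s ≪ t = All (λ x → All (x ℕ.<_) t) s

≪-trans : ∀ {s t u} → NE t → s ≪ t → t ≪ u → s ≪ u
≪-trans t≢[] s≪t t≪u = All.map (λ x<t → All.map (ℕₚ.<-trans (All-minL t≢[] x<t)) (All-minL t≢[] t≪u)) s≪t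

≺-trans : Transitive _≺_
≺-trans (s≢[] , t≢[] , s≪t) (_ , u≢[] , t≪u) = s≢[] , u≢[] , ≪-trans t≢[] s≪t t≪u

Increasing : (ℕ → ℕ) → Set
Increasing u = ∀ i → u i ℕ.< u (suc i)

-- Needed because fundamental sequences are only constrained at indices ≥ 1.
Positive : (ℕ → ℕ) → Set
Positive u = ∀ i → 1 ℕ.≤ u i

applyUpTo-++ : ∀ {A : Set} (u : ℕ → A) k K → applyUpTo u k ++ applyUpTo (λ i → u (k + i)) K ≡ applyUpTo u (k + K)
applyUpTo-++ u zero    K = refl
applyUpTo-++ u (suc k) K = cong (u 0 ∷_) (applyUpTo-++ (u ∘ suc) k K)

applyUpTo-≪ : ∀ u → Increasing u → ∀ k K → applyUpTo u k ≪ applyUpTo (λ i → u (k + i)) K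
applyUpTo-≪ u inc k K = Allₚ.applyUpTo⁺₁ u k λ i<k → Allₚ.applyUpTo⁺₂ (λ i → u (k + i)) K λ j →
  stepwise⇒monotone {R = ℕ._<_} ℕₚ.<-trans u inc (ℕₚ.<-≤-trans i<k (ℕₚ.m≤m+n k j))

Comparable : {A : Set} → List A → List A → Set
Comparable s t = (Σ _ λ r → s ++ r ≡ t) ⊎ (Σ _ λ r → t ++ r ≡ s)

Comparable-∷⁺ : ∀ {A : Set} {x : A} {s t} → Comparable s t → Comparable (x ∷ s) (x ∷ t)
Comparable-∷⁺ (inj₁ (r , s++r≡t)) = inj₁ (r , cong (_ ∷_) s++r≡t)
Comparable-∷⁺ (inj₂ (r , t++r≡s)) = inj₂ (r , cong (_ ∷_) t++r≡s)

Comparable-∷⁻ : ∀ {A : Set} {x y : A} {s t} → Comparable (x ∷ s) (y ∷ t) → x ≡ y × Comparable s t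
Comparable-∷⁻ (inj₁ (r , refl)) = refl , inj₁ (r , refl)
Comparable-∷⁻ (inj₂ (r , refl)) = refl , inj₂ (r , refl)

Comparable-++⁻ : ∀ {A : Set} (a b : List A) {X Y} → Comparable (a ++ X) (b ++ Y) → Comparable a b
Comparable-++⁻ []      b       _ = inj₁ (b , refl)
Comparable-++⁻ (x ∷ a) []      _ = inj₂ (x ∷ a , refl)
Comparable-++⁻ (x ∷ a) (y ∷ b) c with Comparable-∷⁻ c
... | refl , c′ = Comparable-∷⁺ (Comparable-++⁻ a b c′)

Comparable-++-cancelˡ : ∀ {A : Set} (a : List A) {X Y} → Comparable (a ++ X) (a ++ Y) → Comparable X Y
Comparable-++-cancelˡ []      c = c
Comparable-++-cancelˡ (x ∷ a) c = Comparable-++-cancelˡ a (proj₂ (Comparable-∷⁻ c))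

Comparable⇒minL≡ : ∀ {s t} → NE s → NE t → Comparable s t → minL s ≡ minL t
Comparable⇒minL≡ {[]}    s≢[] _    _ = ⊥-elim (s≢[] refl)
Comparable⇒minL≡ {_ ∷ _} {[]} _ t≢[] _ = ⊥-elim (t≢[] refl)
Comparable⇒minL≡ {_ ∷ _} {_ ∷ _} _ _ c = proj₁ (Comparable-∷⁻ c)

applyUpTo-comparable : ∀ {A : Set} (u : ℕ → A) m n → Comparable (applyUpTo u m) (applyUpTo u n)
applyUpTo-comparable u zero    n       = inj₁ (applyUpTo u n , refl)
applyUpTo-comparable u (suc m) zero    = inj₂ (applyUpTo u (suc m) , refl)
applyUpTo-comparable u (suc m) (suc n) = Comparable-∷⁺ (applyUpTo-comparable (u ∘ suc) m n)

concatMap-NE : ∀ (G : ℕ → List ℕ) → (∀ n → NE (G n)) → ∀ {I} → NE I → NE (concatMap G I)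
concatMap-NE G G≢[] {[]}    I≢[] = ⊥-elim (I≢[] refl)
concatMap-NE G G≢[] {i ∷ _} _    = ++-NE {xs = G i} (G≢[] i)

concatMap-sorted : ∀ (G : ℕ → List ℕ) → (∀ n → Linked ℕ._<_ (G n)) → (∀ {i j} → i ℕ.< j → G i ≪ G j) →
                   ∀ {I} → Linked ℕ._<_ I → Linked ℕ._<_ (concatMap G I)
concatMap-sorted G G-sorted G-≪ I-sorted = Linkedₚ.AllPairs⇒Linked (AllPairsₚ.concat⁺
  (Allₚ.map⁺ (All.universal (Linkedₚ.Linked⇒AllPairs ℕₚ.<-trans ∘ G-sorted) _))
  (AllPairsₚ.map⁺ (AllPairs.map G-≪ (Linkedₚ.Linked⇒AllPairs ℕₚ.<-trans I-sorted))))

≪-concatMap⁻ : ∀ (G : ℕ → List ℕ) → (∀ n → NE (G n)) → ∀ I J → concatMap G I ≪ concatMap G J →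
               All (λ i → All (λ j → minL (G i) ℕ.< minL (G j)) J) I
≪-concatMap⁻ G G≢[] I J GI≪GJ =
  All.map (split J) (split {λ x → All (x ℕ.<_) (concatMap G J)} I GI≪GJ)
  where
  split : ∀ {P : ℕ → Set} K → All P (concatMap G K) → All (λ k → P (minL (G k))) K
  split K = All.map (All-minL (G≢[] _)) ∘ Allₚ.map⁻ ∘ Allₚ.concat⁻

≺⇒minL< : ∀ {s t} → s ≺ t → minL s ℕ.< minL t
≺⇒minL< (s≢[] , t≢[] , s≪t) = All-minL t≢[] (All-minL s≢[] s≪t)

InfColl-≺ : ∀ {D} → InfColl D → ∀ {i j} → i ℕ.< j → D i ≺ D j
InfColl-≺ {D} (_ , chain) = stepwise⇒monotone {R = _≺_} ≺-trans D chain

module _ {D : ℕ → List ℕ} (infD : InfColl D) where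

  private
    members : ∀ n → NEFinSet (D n)
    members = proj₁ infD
    chain : ∀ n → D n ≺ D (suc n)
    chain = proj₂ infD

  InfColl-minL-<⁻ : ∀ i j → minL (D i) ℕ.< minL (D j) → i ℕ.< j
  InfColl-minL-<⁻ i j Dᵢ<Dⱼ with ℕ.<-cmp i j
  ... | tri< i<j _ _ = i<j
  ... | tri≈ _ refl _ = ⊥-elim (ℕₚ.<-irrefl refl Dᵢ<Dⱼ)
  ... | tri> _ _ j<i = ⊥-elim (ℕₚ.<-asym Dᵢ<Dⱼ (≺⇒minL< (InfColl-≺ infD j<i)))

  InfColl-minL-increasing : Increasing (minL ∘ D)
  InfColl-minL-increasing = ≺⇒minL< ∘ chain

  InfColl-minL-positive : Positive (minL ∘ D)
  InfColl-minL-positive n = All-minL (proj₁ (members n)) (proj₂ (proj₂ (members n)))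

  InfColl-initSeg : ∀ k → FinColl (initSeg D k)
  InfColl-initSeg k = Allₚ.applyUpTo⁺₂ D k members , Linkedₚ.applyUpTo⁺₂ D k chain

  InfColl-above-index : ∀ n → All (n ℕ.<_) (D n)
  InfColl-above-index zero    = proj₂ (proj₂ (members 0))
  InfColl-above-index (suc n) =
    All.map (ℕₚ.≤-<-trans (All-minL Dₙ≢[] (InfColl-above-index n))) (All-minL Dₙ≢[] Dₙ≪Dₙ₊₁)
    where
    Dₙ≢[] : NE (D n)
    Dₙ≢[] = proj₁ (members n)
    Dₙ≪Dₙ₊₁ : D n ≪ D (suc n)
    Dₙ≪Dₙ₊₁ = proj₂ (proj₂ (chain n))

  FU-NEFinSet : ∀ {t} → FU D t → NEFinSet t
  FU-NEFinSet (I , I≢[] , I-sorted , refl) =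
    concatMap-NE D (proj₁ ∘ members) I≢[] ,
    concatMap-sorted D (proj₁ ∘ proj₂ ∘ members) (proj₂ ∘ proj₂ ∘ InfColl-≺ infD) I-sorted ,
    Allₚ.concat⁺ (Allₚ.map⁺ (All.universal (proj₂ ∘ proj₂ ∘ members) I))

  FU-trans : ∀ {E t} → InfColl E → E <ᶜ D → FU E t → FU D t
  FU-trans {E} infE E<D (J , J≢[] , J-sorted , refl) =
    concatMap I J ,
    concatMap-NE I (proj₁ ∘ proj₂ ∘ E<D) J≢[] ,
    concatMap-sorted I (proj₁ ∘ proj₂ ∘ proj₂ ∘ E<D) I-≪ J-sorted ,
    E≡D J
    where
    I : ℕ → List ℕ
    I j = proj₁ (E<D j)
    Eⱼ≡ : ∀ j → E j ≡ concatMap D (I j)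
    Eⱼ≡ j = proj₂ (proj₂ (proj₂ (E<D j)))
    E≡D : ∀ J → concatMap E J ≡ concatMap D (concatMap I J)
    E≡D []      = refl
    E≡D (j ∷ J) = trans (cong₂ _++_ (Eⱼ≡ j) (E≡D J)) (sym (Listₚ.concatMap-++ D (I j) (concatMap I J)))
    I-≪ : ∀ {i j} → i ℕ.< j → I i ≪ I j
    I-≪ {i} {j} i<j = All.map (λ {x} → All.map (λ {y} → InfColl-minL-<⁻ x y))
      (≪-concatMap⁻ D (proj₁ ∘ members) (I i) (I j) (subst₂ _≪_ (Eⱼ≡ i) (Eⱼ≡ j) (proj₂ (proj₂ (InfColl-≺ infE i<j)))))

FU-InfColl : ∀ {Ds : ℕ → ℕ → List ℕ} {s : ℕ → List ℕ} →
             (∀ n → InfColl (Ds n)) → (∀ n → FU (Ds n) (s n)) → (∀ n → s n ≺ s (suc n)) → InfColl s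
FU-InfColl {Ds} infDs s∈FU chain = (λ n → FU-NEFinSet {Ds n} (infDs n) (s∈FU n)) , chain

<ᶜ-refl : ∀ D → D <ᶜ D
<ᶜ-refl D n = n ∷ [] , (λ ()) , [-] , sym (Listₚ.++-identityʳ (D n))

prepend : ∀ {A : Set} → List A → (ℕ → A) → ℕ → A
prepend []      g i       = g i
prepend (x ∷ c) g zero    = x
prepend (x ∷ c) g (suc i) = prepend c g i

applyUpTo-prepend : ∀ {A : Set} (c : List A) g → applyUpTo (prepend c g) (length c) ≡ c
applyUpTo-prepend []      g = refl
applyUpTo-prepend (x ∷ c) g = cong (x ∷_) (applyUpTo-prepend c g)

prepend-All : ∀ {A : Set} {P : A → Set} {c g} → All P c → (∀ j → P (g j)) → ∀ n → P (prepend c g n)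
prepend-All []       Pg n       = Pg n
prepend-All (Px ∷ _) _  zero    = Px
prepend-All (_ ∷ Pc) Pg (suc n) = prepend-All Pc Pg n

prepend-stepwise : ∀ {A : Set} {R : A → A → Set} {c g} → Linked R c → All (λ x → R x (g 0)) c →
                   (∀ j → R (g j) (g (suc j))) → ∀ n → R (prepend c g n) (prepend c g (suc n))
prepend-stepwise []        []          step n       = step n
prepend-stepwise [-]       (Rxg₀ ∷ []) step zero    = Rxg₀
prepend-stepwise (Rxy ∷ _) _           step zero    = Rxy
prepend-stepwise c-linked  (_ ∷ Rcg₀)  step (suc n) = prepend-stepwise (Linked.tail c-linked) Rcg₀ step n

BfinOf-extends : ∀ {D} → InfColl D → ∀ c → BfinOf D c →
                 Σ (ℕ → List ℕ) λ sq → initSeg sq (length c) ≡ c × (∀ n → FU D (sq n)) × (∀ n → sq n ≺ sq (suc n))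
BfinOf-extends {D} infD@(members , chain) c ((c-sets , c-chain) , c∈FU) =
  prepend c tail , applyUpTo-prepend c tail , prepend-All c∈FU (λ j → <ᶜ-refl D (N + j)) ,
  prepend-stepwise c-chain (All.zipWith c≺tail₀ (c-sets , Allₚ.concat⁻ (xs≤max 0 (concat c)))) tail-chain
  where
  -- Members of D n exceed n, so D N, D (N + 1), … all lie above c.
  N : ℕ
  N = max 0 (concat c)
  tail : ℕ → List ℕ
  tail j = D (N + j)
  tail-chain : ∀ j → tail j ≺ tail (suc j)
  tail-chain j = subst (λ m → D (N + j) ≺ D m) (sym (ℕₚ.+-suc N j)) (chain (N + j))
  c≺tail₀ : ∀ {s} → NEFinSet s × All (ℕ._≤ N) s → s ≺ tail 0
  c≺tail₀ ((s≢[] , _) , s≤N) = s≢[] , proj₁ (members (N + 0)) ,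
    All.map (λ x≤N → All.map (ℕₚ.≤-<-trans (ℕₚ.≤-trans x≤N (ℕₚ.m≤m+n N 0))) (InfColl-above-index infD (N + 0)))
            s≤N

module Schreier (em : ExcludedMiddle 0ℓ) (F : FundSeq) where
  open Classical em
  open FundSeq F

  𝒜-≤0⇒[] : ∀ {ξ t} → 𝒜 F ξ t → ξ ≤ₒ ozero → t ≡ []
  𝒜-≤0⇒[] (a-zero _) _ = refl
  𝒜-≤0⇒[] {ξ} (a-suc {ζ = ζ} (_ , sζ≤ξ) _ _) ξ≤0 =
    ⊥-elim (<ₒ⇒≱ₒ ozero ξ (<ₒ-≤ₒ-trans ozero (osuc ζ) ξ tt sζ≤ξ) ξ≤0)
  𝒜-≤0⇒[] {ξ} (a-pow-suc {β = β} _ (_ , ≤ξ) _ _ _ _ _) ξ≤0 =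
    ⊥-elim (<ₒ⇒≱ₒ ozero ξ (<ₒ-≤ₒ-trans ozero (ω^ osuc β) ξ (ω^-positive (osuc β)) ≤ξ) ξ≤0)
  𝒜-≤0⇒[] {ξ} (a-pow-lim {γ = γ} _ (_ , ≤ξ) _ _) ξ≤0 =
    ⊥-elim (<ₒ⇒≱ₒ ozero ξ (<ₒ-≤ₒ-trans ozero (ω^ γ) ξ (ω^-positive γ) ≤ξ) ξ≤0)
  𝒜-≤0⇒[] {ξ} (a-cnf a p ts _ (_ , ≤ξ) 1≤p cs lk _ _ _ _ _) ξ≤0 =
    ⊥-elim (<ₒ⇒≱ₒ ozero ξ (<ₒ-≤ₒ-trans ozero (cnfVal ((a , p) ∷ ts)) ξ (cnfVal-positive a p ts (lk , 1≤p ∷ cs)) ≤ξ)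
                   ξ≤0)

  𝒜-nonempty : ∀ {ξ s} → ozero <ₒ ξ → 𝒜 F ξ s → NE s
  𝒜-nonempty {ξ} 0<ξ (a-zero (ξ≤0 , _))          = ⊥-elim (<ₒ⇒≱ₒ ozero ξ 0<ξ ξ≤0)
  𝒜-nonempty _ (a-suc _ _ _)                      = λ ()
  𝒜-nonempty _ (a-pow-suc _ _ ss≢[] _ nonempty _ _) = concat-NE ss≢[] nonempty
  𝒜-nonempty _ (a-pow-lim _ _ s≢[] _)             = s≢[]
  𝒜-nonempty _ (a-cnf a p ts _ _ 1≤p _ _ _ _ pw nonempty _) = concat-NE (Pointwise-NE pw (expand-NE a p ts 1≤p)) nonempty

  HasInitialSegments : Ord → Set
  HasInitialSegments ξ = ∀ u → Increasing u → Positive u → Σ ℕ λ k → 𝒜 F ξ (applyUpTo u k)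

  record BlockDecomposition (es : List Ord) (u : ℕ → ℕ) : Set where
    field
      blocks   : List (List ℕ)
      members  : Pointwise (λ e s → 𝒜 F (ω^ e) s) es blocks
      nonempty : All NE blocks
      ordered  : Linked _≺_ blocks
      extent   : ℕ
      covers   : concat blocks ≡ applyUpTo u extent

  blockDecomposition : ∀ es → All (HasInitialSegments ∘ ω^_) es →
                       ∀ u → Increasing u → Positive u → BlockDecomposition es u
  blockDecomposition [] [] u _ _ = record
    { blocks = [] ; members = [] ; nonempty = [] ; ordered = [] ; extent = 0 ; covers = refl }
  blockDecomposition (e ∷ es) (segments ∷ segmentss) u inc pos with segments u inc pos
  ... | k , d = record
    { blocks   = applyUpTo u k ∷ blocks
    ; members  = d ∷ members
    ; nonempty = first≢[] ∷ nonempty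
    ; ordered  = first≺ blocks nonempty covers ∷′ ordered
    ; extent   = k + extent
    ; covers   = trans (cong (applyUpTo u k ++_) covers) (applyUpTo-++ u k extent)
    }
    where
    v : ℕ → ℕ
    v i = u (k + i)
    v-increasing : Increasing v
    v-increasing i = subst (λ m → u (k + i) ℕ.< u m) (sym (ℕₚ.+-suc k i)) (inc (k + i))
    open BlockDecomposition (blockDecomposition es segmentss v v-increasing (pos ∘ (k +_)))
    first≢[] : NE (applyUpTo u k)
    first≢[] = 𝒜-nonempty (ω^-positive e) d
    first≺ : ∀ bs → All NE bs → concat bs ≡ applyUpTo v extent →
             Connected _≺_ (just (applyUpTo u k)) (head bs)
    first≺ []       _              _      = just-nothing
    first≺ (b ∷ bs) (b≢[] ∷ _) bs-covers = just (first≢[] , b≢[] ,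
      All.map (Allₚ.++⁻ˡ b ∘ subst (All _) (sym bs-covers)) (applyUpTo-≪ u inc k extent))

  HasInitialSegments-suc : ∀ ξ ζ → ξ ≈ₒ osuc ζ → HasInitialSegments ζ → HasInitialSegments ξ
  HasInitialSegments-suc ξ ζ ξ≈ segments u inc pos with segments (u ∘ suc) (inc ∘ suc) (pos ∘ suc)
  ... | k , d = suc k , a-suc ξ≈ d (Allₚ.applyUpTo⁺₂ (u ∘ suc) k λ i →
                  stepwise⇒monotone {R = ℕ._<_} ℕₚ.<-trans u inc (s≤s z≤n))

  HasInitialSegments-pow-suc : ∀ ξ β → ξ ≈ₒ ω^ osuc β → HasInitialSegments (ω^ β) → HasInitialSegments ξ
  HasInitialSegments-pow-suc ξ β ξ≈ segments u inc pos =
    extent , subst (𝒜 F ξ) covers (a-pow-suc blocks ξ≈ blocks≢[] members′ nonempty ordered (trans length≡ (sym min≡)))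
    where
    open BlockDecomposition (blockDecomposition (replicate (u 0) β) (Allₚ.replicate⁺ (u 0) segments) u inc pos)
    members′ : All (𝒜 F (ω^ β)) blocks
    members′ = proj₁ (Pointwise-replicate⁻ (u 0) members)
    length≡ : length blocks ≡ u 0
    length≡ = proj₂ (Pointwise-replicate⁻ (u 0) members)
    blocks≢[] : NE blocks
    blocks≢[] blocks≡[] = ℕₚ.<-irrefl (trans (cong length (sym blocks≡[])) length≡) (pos 0)
    min≡ : minL (concat blocks) ≡ u 0
    min≡ = trans (cong minL covers) (minL-applyUpTo u extent (subst NE covers (concat-NE blocks≢[] nonempty)))

  HasInitialSegments-pow-lim : ∀ ξ γ (l : IsLimit γ) → ξ ≈ₒ ω^ γ →
                               (∀ η → η <ₒ ξ → HasInitialSegments η) → HasInitialSegments ξ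
  HasInitialSegments-pow-lim ξ γ l ξ≈ below u inc pos with below (ω^ fs γ l (u 0)) ω^γᵤ₀<ξ u inc pos
    where
    ω^γᵤ₀<ξ : ω^ fs γ l (u 0) <ₒ ξ
    ω^γᵤ₀<ξ = begin-strict
      ω^ fs γ l (u 0)  <⟨ ω^-mono-<ₒ (fs γ l (u 0)) γ (fs-below γ l (u 0) (pos 0)) ⟩
      ω^ γ             ≈⟨ ξ≈ ⟨
      ξ                ∎
  ... | k , d = k , a-pow-lim l ξ≈ s≢[] (subst (λ m → 𝒜 F (ω^ fs γ l m) (applyUpTo u k)) (sym min≡) d)
    where
    s≢[] : NE (applyUpTo u k)
    s≢[] = 𝒜-nonempty (ω^-positive (fs γ l (u 0))) d
    min≡ : minL (applyUpTo u k) ≡ u 0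
    min≡ = minL-applyUpTo u k s≢[]

  HasInitialSegments-cnf : ∀ ξ a p ts → ProperCNF a p ts → ξ ≈ₒ cnfVal ((a , p) ∷ ts) →
                           (∀ η → η <ₒ ξ → HasInitialSegments η) → HasInitialSegments ξ
  HasInitialSegments-cnf ξ a p ts proper@(v@(lk , 1≤p ∷ cs) , positive , p≥2⊎ts≢[]) ξ≈ below u inc pos =
    extent , subst (𝒜 F ξ) covers (a-cnf a p ts blocks ξ≈ 1≤p cs lk positive p≥2⊎ts≢[] members nonempty ordered)
    where
    ω^t<ξ : ∀ t → proj₁ t ≤ₒ a → ω^ proj₁ t <ₒ ξ
    ω^t<ξ (e , _) e≤a = begin-strict
      ω^ e                   ≤⟨ ω^-mono-≤ₒ e a e≤a ⟩
      ω^ a                   <⟨ ω^<ₒproperCNF a p ts proper ⟩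
      cnfVal ((a , p) ∷ ts)  ≈⟨ ξ≈ ⟨
      ξ                      ∎
    segments : All (HasInitialSegments ∘ ω^_) (expand ((a , p) ∷ ts))
    segments = All-expand ((a , p) ∷ ts)
      (All.map (λ {t} t≤a → below (ω^ proj₁ t) (ω^t<ξ t t≤a)) (IsCNF-exponents≤ a p ts v))
    open BlockDecomposition (blockDecomposition (expand ((a , p) ∷ ts)) segments u inc pos)

  𝒜-hasInitialSegments : ∀ ξ → HasInitialSegments ξ
  𝒜-hasInitialSegments ξ = go ξ (<ₒ-wellFounded ξ)
    where
    go : ∀ ξ → Acc _<ₒ_ ξ → HasInitialSegments ξ
    go ξ (acc rs) with form ξ
    ... | form-zero ξ≈0              = λ _ _ _ → 0 , a-zero ξ≈0
    ... | form-suc ζ ξ≈              =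
      HasInitialSegments-suc ξ ζ ξ≈ (go ζ (rs (<ₒ-≤ₒ-trans ζ (osuc ζ) ξ (x<ₒosuc ζ) (proj₂ ξ≈))))
    ... | form-pow-suc β ξ≈          =
      HasInitialSegments-pow-suc ξ β ξ≈ (go (ω^ β) (rs (<ₒ-≤ₒ-trans (ω^ β) (ω^ osuc β) ξ (ω^<ₒω^osuc β) (proj₂ ξ≈))))
    ... | form-pow-lim γ l ξ≈        = HasInitialSegments-pow-lim ξ γ l ξ≈ (λ η η<ξ → go η (rs η<ξ))
    ... | form-cnf a p ts proper ξ≈  = HasInitialSegments-cnf ξ a p ts proper ξ≈ (λ η η<ξ → go η (rs η<ξ))

  𝒜-index : ∀ {ξ s} → 𝒜 F ξ s → Ord
  𝒜-index (a-zero _)                           = ozero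
  𝒜-index (a-suc {ζ = ζ} _ _ _)                = osuc ζ
  𝒜-index (a-pow-suc {β = β} _ _ _ _ _ _ _)    = ω^ osuc β
  𝒜-index (a-pow-lim {γ = γ} _ _ _ _)          = ω^ γ
  𝒜-index (a-cnf a p ts _ _ _ _ _ _ _ _ _ _)   = cnfVal ((a , p) ∷ ts)

  ≈ₒ-𝒜-index : ∀ {ξ s} (d : 𝒜 F ξ s) → ξ ≈ₒ 𝒜-index d
  ≈ₒ-𝒜-index (a-zero ξ≈)                      = ξ≈
  ≈ₒ-𝒜-index (a-suc ξ≈ _ _)                   = ξ≈
  ≈ₒ-𝒜-index (a-pow-suc _ ξ≈ _ _ _ _ _)       = ξ≈
  ≈ₒ-𝒜-index (a-pow-lim _ ξ≈ _ _)             = ξ≈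
  ≈ₒ-𝒜-index (a-cnf _ _ _ _ ξ≈ _ _ _ _ _ _ _ _) = ξ≈

  𝒜-index-cong : ∀ {ξ ξ′ s t} (d : 𝒜 F ξ s) (d′ : 𝒜 F ξ′ t) → ξ ≈ₒ ξ′ → 𝒜-index d ≈ₒ 𝒜-index d′
  𝒜-index-cong {ξ} {ξ′} d d′ ξ≈ξ′ = begin-equality
    𝒜-index d   ≈⟨ ≈ₒ-𝒜-index d ⟨
    ξ           ≈⟨ ξ≈ξ′ ⟩
    ξ′          ≈⟨ ≈ₒ-𝒜-index d′ ⟩
    𝒜-index d′  ∎

  mutual
    𝒜-thin : ∀ {ξ ξ′ s t} → 𝒜 F ξ s → 𝒜 F ξ′ t → ξ ≈ₒ ξ′ → Comparable s t → s ≡ t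
    𝒜-thin {ξ} {ξ′} (a-zero (ξ≤0 , _)) d′ (_ , ξ′≤ξ) _ = sym (𝒜-≤0⇒[] d′ (≤ₒ-trans ξ′ ξ ozero ξ′≤ξ ξ≤0))
    𝒜-thin {ξ} {ξ′} d (a-zero (ξ′≤0 , _)) (ξ≤ξ′ , _) _ = 𝒜-≤0⇒[] d (≤ₒ-trans ξ ξ′ ozero ξ≤ξ′ ξ′≤0)
    𝒜-thin d@(a-suc _ e _) d′@(a-suc _ e′ _) ξ≈ξ′ c with Comparable-∷⁻ c
    ... | refl , c′ = cong (_ ∷_) (𝒜-thin e e′ (𝒜-index-cong d d′ ξ≈ξ′) c′)
    𝒜-thin d@(a-pow-suc {β = β} ss _ ss≢[] members nonempty _ len)
           d′@(a-pow-suc {β = β′} ss′ _ ss′≢[] members′ nonempty′ _ len′) ξ≈ξ′ c =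
      cong concat (𝒜-blocks-unique members members′ (ω^-cong β β′ β≈β′) (trans len (trans min≡ (sym len′))) c)
      where
      β≈β′ : β ≈ₒ β′
      β≈β′ = ω^-injective (osuc β) (osuc β′) (𝒜-index-cong d d′ ξ≈ξ′)
      min≡ : minL (concat ss) ≡ minL (concat ss′)
      min≡ = Comparable⇒minL≡ (concat-NE ss≢[] nonempty) (concat-NE ss′≢[] nonempty′) c
    𝒜-thin {s = s} {t} d@(a-pow-lim {γ = γ} l _ s≢[] e) d′@(a-pow-lim {γ = γ′} l′ _ t≢[] e′) ξ≈ξ′ c =
      𝒜-thin e (subst (λ m → 𝒜 F (ω^ fs γ′ l′ m) t) (sym min≡) e′)
               (ω^-cong (fs γ l (minL s)) (fs γ′ l′ (minL s)) γₙ≈γ′ₙ) c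
      where
      min≡ : minL s ≡ minL t
      min≡ = Comparable⇒minL≡ s≢[] t≢[] c
      γₙ≈γ′ₙ : fs γ l (minL s) ≈ₒ fs γ′ l′ (minL s)
      γₙ≈γ′ₙ = fs-ext γ γ′ l l′ (minL s) (ω^-injective γ γ′ (𝒜-index-cong d d′ ξ≈ξ′))
    𝒜-thin d@(a-cnf a p ts _ _ 1≤p cs lk _ _ members _ _)
           d′@(a-cnf a′ p′ ts′ _ _ 1≤p′ cs′ lk′ _ _ members′ _ _) ξ≈ξ′ c =
      cong concat (𝒜-blocks-unique-pointwise members members′ (expand-cong L L′ sameCNF) c)
      where
      L L′ : List (Ord × ℕ)
      L  = (a , p) ∷ ts
      L′ = (a′ , p′) ∷ ts′
      sameCNF : SameCNF L L′
      sameCNF = cnf-unique L L′ (lk , 1≤p ∷ cs) (lk′ , 1≤p′ ∷ cs′) (𝒜-index-cong d d′ ξ≈ξ′)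
    𝒜-thin d@(a-suc {ζ = ζ} _ _ _) d′@(a-pow-suc {β = β} _ _ _ _ _ _ _) ξ≈ξ′ _ =
      ⊥-elim (osuc≉limit ζ (ω^ osuc β) (ω^-isLimit (osuc β) tt) (𝒜-index-cong d d′ ξ≈ξ′))
    𝒜-thin d@(a-pow-suc {β = β} _ _ _ _ _ _ _) d′@(a-suc {ζ = ζ} _ _ _) ξ≈ξ′ _ =
      ⊥-elim (osuc≉limit ζ (ω^ osuc β) (ω^-isLimit (osuc β) tt) (𝒜-index-cong d′ d (swap ξ≈ξ′)))
    𝒜-thin d@(a-suc {ζ = ζ} _ _ _) d′@(a-pow-lim {γ = γ} l _ _ _) ξ≈ξ′ _ =
      ⊥-elim (osuc≉limit ζ (ω^ γ) (ω^-isLimit γ (proj₁ l)) (𝒜-index-cong d d′ ξ≈ξ′))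
    𝒜-thin d@(a-pow-lim {γ = γ} l _ _ _) d′@(a-suc {ζ = ζ} _ _ _) ξ≈ξ′ _ =
      ⊥-elim (osuc≉limit ζ (ω^ γ) (ω^-isLimit γ (proj₁ l)) (𝒜-index-cong d′ d (swap ξ≈ξ′)))
    𝒜-thin d@(a-suc {ζ = ζ} _ _ _) d′@(a-cnf a p ts _ _ 1≤p cs lk positive _ _ _ _) ξ≈ξ′ _ =
      ⊥-elim (osuc≉limit ζ (cnfVal ((a , p) ∷ ts)) (cnfVal-isLimit a p ts (lk , 1≤p ∷ cs) positive) (𝒜-index-cong d d′ ξ≈ξ′))
    𝒜-thin d@(a-cnf a p ts _ _ 1≤p cs lk positive _ _ _ _) d′@(a-suc {ζ = ζ} _ _ _) ξ≈ξ′ _ =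
      ⊥-elim (osuc≉limit ζ (cnfVal ((a , p) ∷ ts)) (cnfVal-isLimit a p ts (lk , 1≤p ∷ cs) positive) (𝒜-index-cong d′ d (swap ξ≈ξ′)))
    𝒜-thin d@(a-pow-suc {β = β} _ _ _ _ _ _ _) d′@(a-pow-lim {γ = γ} l _ _ _) ξ≈ξ′ _ =
      ⊥-elim (ω^osuc≉ω^limit β γ l (𝒜-index-cong d d′ ξ≈ξ′))
    𝒜-thin d@(a-pow-lim {γ = γ} l _ _ _) d′@(a-pow-suc {β = β} _ _ _ _ _ _ _) ξ≈ξ′ _ =
      ⊥-elim (ω^osuc≉ω^limit β γ l (𝒜-index-cong d′ d (swap ξ≈ξ′)))
    𝒜-thin d@(a-pow-suc {β = β} _ _ _ _ _ _ _) d′@(a-cnf a p ts _ _ 1≤p cs lk positive proper _ _ _) ξ≈ξ′ _ =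
      ⊥-elim (ω^≉properCNF (osuc β) a p ts ((lk , 1≤p ∷ cs) , positive , proper) (𝒜-index-cong d d′ ξ≈ξ′))
    𝒜-thin d@(a-cnf a p ts _ _ 1≤p cs lk positive proper _ _ _) d′@(a-pow-suc {β = β} _ _ _ _ _ _ _) ξ≈ξ′ _ =
      ⊥-elim (ω^≉properCNF (osuc β) a p ts ((lk , 1≤p ∷ cs) , positive , proper) (𝒜-index-cong d′ d (swap ξ≈ξ′)))
    𝒜-thin d@(a-pow-lim {γ = γ} _ _ _ _) d′@(a-cnf a p ts _ _ 1≤p cs lk positive proper _ _ _) ξ≈ξ′ _ =
      ⊥-elim (ω^≉properCNF γ a p ts ((lk , 1≤p ∷ cs) , positive , proper) (𝒜-index-cong d d′ ξ≈ξ′))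
    𝒜-thin d@(a-cnf a p ts _ _ 1≤p cs lk positive proper _ _ _) d′@(a-pow-lim {γ = γ} _ _ _ _) ξ≈ξ′ _ =
      ⊥-elim (ω^≉properCNF γ a p ts ((lk , 1≤p ∷ cs) , positive , proper) (𝒜-index-cong d′ d (swap ξ≈ξ′)))

    𝒜-blocks-unique : ∀ {x x′ ss ss′} → All (𝒜 F x) ss → All (𝒜 F x′) ss′ → x ≈ₒ x′ →
                      length ss ≡ length ss′ → Comparable (concat ss) (concat ss′) → ss ≡ ss′
    𝒜-blocks-unique [] [] _ _ _ = refl
    𝒜-blocks-unique {ss = b ∷ _} {b′ ∷ _} (d ∷ ds) (d′ ∷ ds′) x≈x′ len c
      with 𝒜-thin d d′ x≈x′ (Comparable-++⁻ b b′ c)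
    ... | refl = cong (b ∷_) (𝒜-blocks-unique ds ds′ x≈x′ (ℕₚ.suc-injective len) (Comparable-++-cancelˡ b c))

    𝒜-blocks-unique-pointwise : ∀ {es es′ ps ps′} →
      Pointwise (λ e s → 𝒜 F (ω^ e) s) es ps → Pointwise (λ e s → 𝒜 F (ω^ e) s) es′ ps′ →
      Pointwise _≈ₒ_ es es′ → Comparable (concat ps) (concat ps′) → ps ≡ ps′
    𝒜-blocks-unique-pointwise [] [] [] _ = refl
    𝒜-blocks-unique-pointwise {e ∷ _} {e′ ∷ _} {b ∷ _} {b′ ∷ _} (d ∷ ds) (d′ ∷ ds′) (e≈e′ ∷ es≈es′) c
      with 𝒜-thin d d′ (ω^-cong e e′ e≈e′) (Comparable-++⁻ b b′ c)
    ... | refl = cong (b ∷_) (𝒜-blocks-unique-pointwise ds ds′ es≈es′ (Comparable-++-cancelˡ b c))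

  𝒜-initialSegment-unique : ∀ {ξ} u m n → 𝒜 F ξ (applyUpTo u m) → 𝒜 F ξ (applyUpTo u n) → m ≡ n
  𝒜-initialSegment-unique {ξ} u m n d d′ =
    trans (sym (Listₚ.length-applyUpTo u m))
      (trans (cong length (𝒜-thin d d′ (≈ₒ-refl ξ) (applyUpTo-comparable u m n))) (Listₚ.length-applyUpTo u n))

  CondI⇒CondII : ∀ 𝓕 ξ D → CondI F 𝓕 ξ D → CondII F 𝓕 ξ D
  CondI⇒CondII 𝓕 ξ D condI D₁ _ D₁<D k b = condI (initSeg D₁ k) b (proj₁ (proj₂ b) , Allₚ.applyUpTo⁺₂ D₁ k D₁<D)

  CondII⇒CondIII : ∀ 𝓕 ξ → osuc ozero ≤ₒ ξ → ∀ D → InfColl D → CondII F 𝓕 ξ D → CondIII F 𝓕 ξ D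
  CondII⇒CondIII 𝓕 ξ 0<ξ D infD condII Ds infDs Ds<D s s∈FU chain
    with infS ← FU-InfColl {Ds} {s} infDs s∈FU chain
    with 𝒜-hasInitialSegments ξ (minL ∘ s) (InfColl-minL-increasing infS) (InfColl-minL-positive infS)
  ... | zero  , d = ⊥-elim (𝒜-nonempty 0<ξ d refl)
  ... | suc k , d = suc k , s≤s z≤n , s₀…ₖ∈𝓑 , condII s infS s<D (suc k) s₀…ₖ∈𝓑
    where
    s<D : s <ᶜ D
    s<D n = FU-trans infD (infDs n) (Ds<D n) (s∈FU n)
    s₀…ₖ∈𝓑 : 𝓑 F ξ (initSeg s (suc k))
    s₀…ₖ∈𝓑 = (λ ()) , InfColl-initSeg infS (suc k) , subst (𝒜 F ξ) (sym (Listₚ.map-applyUpTo s minL (suc k))) d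

  CondIII⇒CondI : ∀ 𝓕 ξ D → InfColl D → CondIII F 𝓕 ξ D → CondI F 𝓕 ξ D
  CondIII⇒CondI 𝓕 ξ D infD condIII c (_ , _ , c∈𝒜) c∈Bfin with BfinOf-extends infD c c∈Bfin
  ... | sq , sq-init , sq∈FU , sq-chain with condIII (λ _ → D) (λ _ → infD) (λ _ → <ᶜ-refl D) sq sq∈FU sq-chain
  ...   | n₀ , _ , (_ , _ , seg∈𝒜) , seg∈𝓕 = subst 𝓕 (trans (cong (initSeg sq) n₀≡) sq-init) seg∈𝓕
    where
    n₀≡ : n₀ ≡ length c
    n₀≡ = 𝒜-initialSegment-unique (minL ∘ sq) n₀ (length c)
            (subst (𝒜 F ξ) (Listₚ.map-applyUpTo sq minL n₀) seg∈𝒜)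
            (subst (𝒜 F ξ) (trans (cong (map minL) (sym sq-init)) (Listₚ.map-applyUpTo sq minL (length c))) c∈𝒜)

proposition3p5 : ExcludedMiddle 0ℓ →
    (F : FundSeq) (𝓕 : List (List ℕ) → Set) → (∀ c → 𝓕 c → FinColl c) →
    (ξ : Ord) → osuc ozero ≤ₒ ξ →
    (D : ℕ → List ℕ) → InfColl D →
    (CondI F 𝓕 ξ D → CondII F 𝓕 ξ D) ×
    (CondII F 𝓕 ξ D → CondIII F 𝓕 ξ D) ×
    (CondIII F 𝓕 ξ D → CondI F 𝓕 ξ D)
proposition3p5 em F 𝓕 _ ξ 1≤ξ D infD =
  CondI⇒CondII 𝓕 ξ D , CondII⇒CondIII 𝓕 ξ 1≤ξ D infD , CondIII⇒CondI 𝓕 ξ D infD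
  where open Schreier em F
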